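{- Let $G$ be a bicyclic graph of order $n$ with at least one leaf such that $G$ is not isomorphic to $F(n_1,n_2)$ for any nonnegative integers $n_1,n_2$ with $n_1+2n_2=n-5$. If $v$ is a leaf of $G$ and $u$ is a leaf of $B_n$, then $\operatorname{CS}(B_n-N[u],x)\preceq\operatorname{CS}(G-N[v],x)$.
   Context: All graphs are finite, simple and undirected. A bicyclic graph is a connected graph $G$ with $|E(G)|=|V(G)|+1$. A leaf is a vertex of degree $1$. $N[v]$ is the closed neighbourhood of $v$ and $G-N[v]$ is obtained by deleting all vertices of $N[v]$. $F(n_1,n_2)$ is the graph with a central vertex $z$, two triangles $z a_1 b_1$ and $z a_2 b_2$ sharing only $z$, $n_1$ pendant leaves at $z$, and $n_2$ pendant paths $z\,x_i\,y_i$ of length $2$ at $z$ (order $5+n_1+2n_2$). $B_n$ is the graph with vertices $c,a,b,w$ and $n-4$ further vertices, where $c$ is adjacent to all other vertices and the only other edges are $ab$ and $aw$. A connected set is a vertex subset inducing a connected subgraph; $S_k(G)$ is the number of connected sets of size $k$ and $\operatorname{CS}(G,x)=\sum_{k\ge1}S_k(G)x^k$. For polynomials $A(x)=\sum_{k=0}^n a_kx^k$, $B(x)=\sum_{k=0}^m b_kx^k$, write $B(x)\preceq A(x)$ if $m\le n$ and $b_k\le a_k$ for all $k$. -}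

module Defs where

open import Data.Bool using (Bool; true; false; not; _∧_; _∨_; if_then_else_)
open import Data.Bool.Properties using (∨-comm)
open import Data.Nat using (ℕ; zero; suc; _+_; _*_; _∸_; _≡ᵇ_; _<ᵇ_; _≤_)
open import Data.Fin using (Fin; toℕ; _≟_)
open import Data.Fin.Subset using (Subset; _∈_; _⊆_; Nonempty; ∣_∣)
import Data.Fin.Subset as Sub
open import Data.Vec using (tabulate)
open import Data.List using (List; map; allFin)
open import Data.Nat.ListAction using (sum)
open import Data.Product using (Σ; _×_; _,_)
open import Relation.Binary.PropositionalEquality using (_≡_; refl; cong₂)
open import Relation.Nullary using (¬_; does)
open import Function.Bundles using (_↔_; Inverse)

record Graph (n : ℕ) : Set where
  field
    adj    : Fin n → Fin n → Bool
    sym    : ∀ i j → adj i j ≡ adj j i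
    irrefl : ∀ i → adj i i ≡ false
open Graph public

Iso : ∀ {n m} → Graph n → Graph m → Set
Iso {n} {m} G H =
  Σ (Fin n ↔ Fin m) λ f → ∀ i j → adj H (Inverse.to f i) (Inverse.to f j) ≡ adj G i j

degree : ∀ {n} → Graph n → Fin n → ℕ
degree G v = ∣ tabulate (adj G v) ∣

IsLeaf : ∀ {n} → Graph n → Fin n → Set
IsLeaf G v = degree G v ≡ 1

edgeCount : ∀ {n} → Graph n → ℕ
edgeCount {n} G =
  sum (map (λ i → ∣ tabulate (λ j → (toℕ i <ᵇ toℕ j) ∧ adj G i j) ∣) (allFin n))

data Reach {n : ℕ} (G : Graph n) (S : Subset n) : Fin n → Fin n → Set where
  here : ∀ {u} → u ∈ S → Reach G S u u
  step : ∀ {u w v} → u ∈ S → adj G u w ≡ true → Reach G S w v → Reach G S u v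

ConnectedSet : ∀ {n} → Graph n → Subset n → Set
ConnectedSet G S = Nonempty S × (∀ u v → u ∈ S → v ∈ S → Reach G S u v)

Connected : ∀ {n} → Graph n → Set
Connected {n} G = ConnectedSet G Sub.⊤

Bicyclic : ∀ {n} → Graph n → Set
Bicyclic {n} G = Connected G × edgeCount G ≡ n + 1

outsideN : ∀ {n} → Graph n → Fin n → Subset n
outsideN G v = tabulate (λ j → not (does (j ≟ v)) ∧ not (adj G v j))

-- Connected sets of size k of the induced subgraph G[A]
-- (membership proofs irrelevant, so an element is determined by its set).
record ConnSet {n : ℕ} (G : Graph n) (A : Subset n) (k : ℕ) : Set where
  field
    set    : Subset n
    .sub   : set ⊆ A
    .conn  : ConnectedSet G set
    .size  : ∣ set ∣ ≡ k

HasS : ∀ {n} → Graph n → Subset n → ℕ → ℕ → Set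
HasS G A k c = ConnSet G A k ↔ Fin c

-- CS(G'[A'],x) ≼ CS(G[A],x), coefficientwise  (S_k(G'[A']) ≤ S_k(G[A]) for all k)
CSLe : ∀ {n m} → Graph m → Subset m → Graph n → Subset n → Set
CSLe H B G A = ∀ k b a → HasS H B k b → HasS G A k a → b ≤ a

≡ᵇ-sym : ∀ a b → (a ≡ᵇ b) ≡ (b ≡ᵇ a)
≡ᵇ-sym zero zero = refl
≡ᵇ-sym zero (suc b) = refl
≡ᵇ-sym (suc a) zero = refl
≡ᵇ-sym (suc a) (suc b) = ≡ᵇ-sym a b

≡ᵇ-refl : ∀ a → (a ≡ᵇ a) ≡ true
≡ᵇ-refl zero = refl
≡ᵇ-refl (suc a) = ≡ᵇ-refl a

mkGraph : ∀ n → (ℕ → ℕ → Bool) → Graph n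
mkGraph n e = record
  { adj = λ i j → A (toℕ i) (toℕ j)
  ; sym = λ i j → symA (toℕ i) (toℕ j)
  ; irrefl = λ i → irrA (toℕ i) }
  where
  A : ℕ → ℕ → Bool
  A a b = not (a ≡ᵇ b) ∧ (e a b ∨ e b a)
  symA : ∀ a b → A a b ≡ A b a
  symA a b = cong₂ (λ x y → not x ∧ y) (≡ᵇ-sym a b) (∨-comm (e a b) (e b a))
  irrA : ∀ a → A a a ≡ false
  irrA a with a ≡ᵇ a | ≡ᵇ-refl a
  ... | .true | refl = refl

-- B_n : c = 0, a = 1, b = 2, w = 3, remaining vertices 4 .. n-1.
-- c adjacent to all others; additionally ab and aw.
bCode : ℕ → ℕ → Bool
bCode i j = (i ≡ᵇ 0) ∨ ((i ≡ᵇ 1) ∧ ((j ≡ᵇ 2) ∨ (j ≡ᵇ 3)))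

B : (n : ℕ) → Graph n
B n = mkGraph n bCode

-- F(n₁,n₂) on 5 + n₁ + 2 n₂ vertices:
-- z = 0, a₁ = 1, b₁ = 2, a₂ = 3, b₂ = 4, leaves 5 .. 4+n₁,
-- x_i = 5 + n₁ + 2i, y_i = 6 + n₁ + 2i  (0 ≤ i < n₂).
isEven : ℕ → Bool
isEven zero = true
isEven (suc zero) = false
isEven (suc (suc k)) = isEven k

fCode : ℕ → ℕ → ℕ → Bool
fCode n₁ i j =
     ((i ≡ᵇ 0) ∧ ((j ≡ᵇ 1) ∨ (j ≡ᵇ 2) ∨ (j ≡ᵇ 3) ∨ (j ≡ᵇ 4)))
  ∨ ((i ≡ᵇ 1) ∧ (j ≡ᵇ 2))
  ∨ ((i ≡ᵇ 3) ∧ (j ≡ᵇ 4))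
  ∨ ((i ≡ᵇ 0) ∧ (4 <ᵇ j) ∧ (j <ᵇ 5 + n₁))
  ∨ ((i ≡ᵇ 0) ∧ (4 + n₁ <ᵇ j) ∧ isEven (j ∸ (5 + n₁)))          -- z x_i
  ∨ ((4 + n₁ <ᵇ i) ∧ isEven (i ∸ (5 + n₁)) ∧ (j ≡ᵇ suc i))     -- x_i y_i

F : (n₁ n₂ : ℕ) → Graph (5 + n₁ + 2 * n₂)
F n₁ n₂ = mkGraph (5 + n₁ + 2 * n₂) (fCode n₁)

{-# OPTIONS --safe #-}
-- Let p be the neighbour of the leaf v. For n ≥ 5 a leaf u of B_n is one of the further
-- vertices, and B_n - N[u] is the path b a w together with n - 5 isolated vertices.
--
-- If G - N[v] contains a path x y z, a permutation of the vertices sending c, u, a, b, w to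
-- p, v, y, x, z embeds B_n - N[u] into G - N[v]; an embedding maps connected sets injectively
-- to connected sets of the same size, which gives the coefficientwise inequality.
--
-- Otherwise every vertex of G - N[v] has at most one neighbour there. Connectivity forces
-- each unmatched vertex to be a leaf at p and each matched pair to meet p. Counting
-- vertices, the degree of p and the degree sum (handshake lemma with |E| = n + 1) shows that
-- exactly two matched pairs lie in triangles with p, so G is F(n₁,n₂), which is excluded.
-- For n = 2 the set B_2 - N[u] is empty.
module Submission where

open import Data.Bool using (Bool; true; false; not; _∧_; _∨_; T; if_then_else_)
import Data.Bool.Properties as Boolₚ
open import Data.Bool.Properties using (∨-zeroʳ; ∨-identityʳ; ∧-zeroʳ; ∧-identityʳ; T-≡)
open import Data.Empty using (⊥; ⊥-elim)
import Data.Empty.Irrelevant as Irr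
open import Data.Unit using (⊤; tt)
open import Data.Product using (Σ; _×_; _,_; proj₁; proj₂; uncurry)
open import Data.Sum using (_⊎_; inj₁; inj₂)
import Data.Sum as Sum using ([_,_]; swap)
open import Data.Nat using (ℕ; zero; suc; _+_; _*_; _∸_; ⌊_/2⌋; _≤_; _<_; _<ᵇ_; _≡ᵇ_; z≤n; s≤s)
open import Data.Nat.Properties hiding (_≟_; <ᵇ⇒<; <⇒<ᵇ)
import Data.Nat.Properties as ℕₚ
open import Data.Nat.Solver using (module +-*-Solver)
import Data.Nat.ListAction as List using (sum)
import Data.List as List using (map; tabulate)
open import Data.Fin using (Fin; zero; suc; toℕ; _≟_; punchOut; fromℕ<)
open import Data.Fin.Patterns using (0F; 1F; 2F; 3F; 4F; 5F)
import Data.Fin.Properties as Finₚ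
open import Data.Fin.Subset using (Subset; _∈_; _⊆_; ∣_∣)
import Data.Fin.Subset as Sub using (⊤)
open import Data.Fin.Subset.Properties using (_∈?_; ∈⊤)
import Data.Fin.Permutation as Perm
import Data.Fin.Permutation.Components as PC
open import Data.Fin.Permutation
  using (Permutation; Permutation′; _∘ₚ_; transpose; permutation; _⟨$⟩ʳ_; _⟨$⟩ˡ_; inverseˡ; inverseʳ)
open import Data.Vec using (Vec; []; _∷_; tabulate; lookup)
open import Data.Vec.Properties using (lookup∘tabulate; tabulate∘lookup; tabulate-cong; []=⇒lookup; lookup⇒[]=)
open import Data.Vec.Relation.Unary.All using (All; []; _∷_)
open import Data.Vec.Relation.Unary.AllPairs using ([]; _∷_)
open import Data.Vec.Relation.Unary.Unique.Propositional using (Unique)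
open import Data.Vec.Relation.Binary.Pointwise.Inductive as Pointwise using (Pointwise; []; _∷_)
open import Algebra.Properties.Semiring.Sum +-*-semiring
  using (sum; sum-cong-≗; ∑-distrib-+; ∑-comm; ∑-permute; *-distribˡ-sum)
open import Function using (_∘_; _∘₂_; flip)
open import Function.Bundles using (_↔_; Equivalence; Inverse; Injection; mk↔ₛ′)
open import Function.Properties.Inverse using (↔⇒↣; ↔-sym)
open import Relation.Nullary using (¬_; ¬?; Dec; does; yes; no; _×-dec_; _⊎-dec_)
open import Relation.Nullary.Decidable using (decidable-stable)
open import Relation.Binary.Definitions using (tri<; tri≈; tri>)
open import Relation.Binary.PropositionalEquality
open import Defs hiding (sym)

<ᵇ⇒< : ∀ {m n} → (m <ᵇ n) ≡ true → m < n
<ᵇ⇒< {m} {n} eq = ℕₚ.<ᵇ⇒< m n (subst T (sym eq) tt)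

<⇒<ᵇ : ∀ {m n} → m < n → (m <ᵇ n) ≡ true
<⇒<ᵇ m<n = Equivalence.to T-≡ (ℕₚ.<⇒<ᵇ m<n)

≢⇒≡ᵇ-false : ∀ {m n} → ¬ m ≡ n → (m ≡ᵇ n) ≡ false
≢⇒≡ᵇ-false {zero}  {zero}  m≢n = ⊥-elim (m≢n refl)
≢⇒≡ᵇ-false {zero}  {suc n} _   = refl
≢⇒≡ᵇ-false {suc m} {zero}  _   = refl
≢⇒≡ᵇ-false {suc m} {suc n} m≢n = ≢⇒≡ᵇ-false (m≢n ∘ cong suc)

≤⇒<ᵇ-false : ∀ {m n} → n ≤ m → (m <ᵇ n) ≡ false
≤⇒<ᵇ-false {n = zero}  _         = refl
≤⇒<ᵇ-false {n = suc n} (s≤s n≤m) = ≤⇒<ᵇ-false n≤m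

m+1+n∸m≡1+n : ∀ m n → suc (m + n) ∸ m ≡ suc n
m+1+n∸m≡1+n m n = trans (cong (_∸ m) (sym (+-suc m n))) (m+n∸m≡n m (suc n))

-- Counting over Fin

indicator : Bool → ℕ
indicator true  = 1
indicator false = 0

count : ∀ {n} → (Fin n → Bool) → ℕ
count f = sum (λ i → indicator (f i))

∣tabulate∣≡count : ∀ {n} (f : Fin n → Bool) → ∣ tabulate f ∣ ≡ count f
∣tabulate∣≡count {zero}  f = refl
∣tabulate∣≡count {suc n} f with f zero
... | true  = cong suc (∣tabulate∣≡count (λ i → f (suc i)))
... | false = ∣tabulate∣≡count (λ i → f (suc i))

sum-mono-≤ : ∀ {n} {f g : Fin n → ℕ} → (∀ i → f i ≤ g i) → sum f ≤ sum g
sum-mono-≤ {zero}  f≤g = z≤n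
sum-mono-≤ {suc n} f≤g = +-mono-≤ (f≤g zero) (sum-mono-≤ (λ i → f≤g (suc i)))

sum-mono-< : ∀ {n} {f g : Fin n → ℕ} (a : Fin n) → (∀ i → f i ≤ g i) → f a < g a → sum f < sum g
sum-mono-< zero    f≤g fa<ga = +-mono-<-≤ fa<ga (sum-mono-≤ (λ i → f≤g (suc i)))
sum-mono-< (suc a) f≤g fa<ga = +-mono-≤-< (f≤g zero) (sum-mono-< a (λ i → f≤g (suc i)) fa<ga)

sum-const : ∀ n (c : ℕ) → sum {n} (λ _ → c) ≡ n * c
sum-const zero    c = refl
sum-const (suc n) c = cong (c +_) (sum-const n c)

count-none : ∀ {n} {f : Fin n → Bool} → (∀ i → f i ≡ false) → count f ≡ 0
count-none {zero}          none = refl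
count-none {suc n} {f} none rewrite none zero = count-none (λ i → none (suc i))

count-mono : ∀ {n} {f g : Fin n → Bool} → (∀ i → f i ≡ true → g i ≡ true) → count f ≤ count g
count-mono {f = f} {g} f⇒g = sum-mono-≤ pointwise
  where
  pointwise : ∀ i → indicator (f i) ≤ indicator (g i)
  pointwise i with f i in fi
  ... | false = z≤n
  ... | true  rewrite f⇒g i fi = ≤-refl

point : ∀ {n} → Fin n → Fin n → Bool
point a i = does (i ≟ a)

count-point : ∀ {n} (a : Fin n) → count (point a) ≡ 1
count-point {suc n} zero = cong suc (count-none {n} {λ i → point zero (suc i)} (λ _ → refl))
count-point (suc a)      = count-point a

point-self : ∀ {n} (a : Fin n) → point a a ≡ true
point-self a with a ≟ a
... | yes _ = refl
... | no a≢a = ⊥-elim (a≢a refl)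

point-true : ∀ {n} {a i : Fin n} → point a i ≡ true → i ≡ a
point-true {a = a} {i} eq with i ≟ a
... | yes i≡a = i≡a

point-involution : ∀ {k} {σ : Fin k → Fin k} → (∀ i → σ (σ i) ≡ i) →
                   ∀ a i → point a (σ i) ≡ point (σ a) i
point-involution {σ = σ} σ∘σ a i with σ i ≟ a | i ≟ σ a
... | yes _    | yes _    = refl
... | no _     | no _     = refl
... | yes refl | no i≢σa  = ⊥-elim (i≢σa (sym (σ∘σ i)))
... | no σi≢a  | yes refl = ⊥-elim (σi≢a (σ∘σ a))

count-pair : ∀ {n} {a b : Fin n} → ¬ a ≡ b → count (λ i → point a i ∨ point b i) ≡ 2
count-pair {a = a} {b} a≢b = begin
  count (λ i → point a i ∨ point b i)                   ≡⟨ sum-cong-≗ pointwise ⟩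
  sum (λ i → indicator (point a i) + indicator (point b i)) ≡⟨ ∑-distrib-+ (λ i → indicator (point a i)) _ ⟩
  count (point a) + count (point b)                     ≡⟨ cong₂ _+_ (count-point a) (count-point b) ⟩
  2                                                     ∎
  where
  open ≡-Reasoning
  pointwise : ∀ i → indicator (point a i ∨ point b i) ≡ indicator (point a i) + indicator (point b i)
  pointwise i with i ≟ a | i ≟ b
  ... | yes refl | yes refl = ⊥-elim (a≢b refl)
  ... | yes _    | no _     = refl
  ... | no _     | yes _    = refl
  ... | no _     | no _     = refl

module _ {n} {f : Fin n → Bool} where

  count-≡1 : ∀ {a} → f a ≡ true → (∀ i → f i ≡ true → i ≡ a) → count f ≡ 1
  count-≡1 {a} fa only-a = ≤-antisym (≤-trans (count-mono f⇒point) (≤-reflexive (count-point a)))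
                                     (≤-trans (≤-reflexive (sym (count-point a))) (count-mono point⇒f))
    where
    f⇒point : ∀ i → f i ≡ true → point a i ≡ true
    f⇒point i fi rewrite only-a i fi = point-self a
    point⇒f : ∀ i → point a i ≡ true → f i ≡ true
    point⇒f i eq = subst (λ k → f k ≡ true) (sym (point-true eq)) fa

  count-≥2 : ∀ {a b} → f a ≡ true → f b ≡ true → ¬ a ≡ b → 2 ≤ count f
  count-≥2 {a} {b} fa fb a≢b = ≤-trans (≤-reflexive (sym (count-pair a≢b))) (count-mono pair⇒f)
    where
    pair⇒f : ∀ i → (point a i ∨ point b i) ≡ true → f i ≡ true
    pair⇒f i eq with i ≟ a | i ≟ b
    ... | yes refl | _        = fa
    ... | no _     | yes refl = fb

  count-≡2 : ∀ {a b} → f a ≡ true → f b ≡ true → ¬ a ≡ b →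
             (∀ i → f i ≡ true → i ≡ a ⊎ i ≡ b) → count f ≡ 2
  count-≡2 {a} {b} fa fb a≢b only-ab =
    ≤-antisym (≤-trans (count-mono f⇒pair) (≤-reflexive (count-pair a≢b))) (count-≥2 fa fb a≢b)
    where
    f⇒pair : ∀ i → f i ≡ true → (point a i ∨ point b i) ≡ true
    f⇒pair i fi with only-ab i fi
    ... | inj₁ refl = cong (_∨ point b a) (point-self a)
    ... | inj₂ refl = trans (cong (point a b ∨_) (point-self b)) (∨-zeroʳ _)

count-cong : ∀ {n} {f g : Fin n → Bool} → (∀ i → f i ≡ g i) → count f ≡ count g
count-cong {f = f} {g} f≗g =
  sum-cong-≗ {x = λ i → indicator (f i)} {y = λ i → indicator (g i)} (cong indicator ∘ f≗g)

count-involution : ∀ {n} {f g : Fin n → Bool} (σ : Fin n → Fin n) → (∀ i → σ (σ i) ≡ i) →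
                   (∀ i → f (σ i) ≡ g i) → count f ≡ count g
count-involution {f = f} σ σ∘σ f∘σ≗g =
  trans (∑-permute (λ i → indicator (f i)) (permutation σ σ σ∘σ σ∘σ)) (count-cong f∘σ≗g)

sum-weighted-point : ∀ {k} (φ : Fin k → ℕ) (a : Fin k) → sum (λ c → φ c * indicator (point c a)) ≡ φ a
sum-weighted-point {suc k} φ zero = begin
  φ zero * 1 + sum (λ c → φ (suc c) * 0)
    ≡⟨ cong₂ _+_ (*-identityʳ (φ zero)) (sum-cong-≗ (λ c → *-zeroʳ (φ (suc c)))) ⟩
  φ zero + sum {k} (λ _ → 0)             ≡⟨ cong (φ zero +_) (trans (sum-const k 0) (*-zeroʳ k)) ⟩
  φ zero + 0                             ≡⟨ +-identityʳ (φ zero) ⟩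
  φ zero                                 ∎
  where open ≡-Reasoning
sum-weighted-point {suc k} φ (suc a) =
  trans (cong (_+ sum (λ c → φ (suc c) * indicator (point (suc c) (suc a)))) (*-zeroʳ (φ zero)))
        (sum-weighted-point (λ c → φ (suc c)) a)

sum-by-fibres : ∀ {n k} (κ : Fin n → Fin k) (φ : Fin k → ℕ) →
                sum (λ w → φ (κ w)) ≡ sum (λ c → φ c * count (λ w → point c (κ w)))
sum-by-fibres κ φ = begin
  sum (λ w → φ (κ w))
    ≡⟨ sum-cong-≗ (λ w → sym (sum-weighted-point φ (κ w))) ⟩
  sum (λ w → sum (λ c → φ c * indicator (point c (κ w))))
    ≡⟨ ∑-comm (λ w c → φ c * indicator (point c (κ w))) ⟩
  sum (λ c → sum (λ w → φ c * indicator (point c (κ w))))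
    ≡⟨ sum-cong-≗ (λ c → sym (*-distribˡ-sum (φ c) (λ w → indicator (point c (κ w))))) ⟩
  sum (λ c → φ c * count (λ w → point c (κ w)))
    ∎
  where open ≡-Reasoning

rank : ∀ {n} → (Fin n → Bool) → Fin n → ℕ
rank f w = count (λ j → f j ∧ (toℕ j <ᵇ toℕ w))

module _ {n} {f : Fin n → Bool} where

  rank-mono : ∀ {a b} → f a ≡ true → toℕ a < toℕ b → rank f a < rank f b
  rank-mono {a} {b} fa a<b = sum-mono-< a pointwise at-a
    where
    pointwise : ∀ j → indicator (f j ∧ (toℕ j <ᵇ toℕ a)) ≤ indicator (f j ∧ (toℕ j <ᵇ toℕ b))
    pointwise j with f j | toℕ j <ᵇ toℕ a in j<a
    ... | false | _     = z≤n
    ... | true  | false = z≤n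
    ... | true  | true  rewrite <⇒<ᵇ (<-trans (<ᵇ⇒< j<a) a<b) = ≤-refl
    at-a : indicator (f a ∧ (toℕ a <ᵇ toℕ a)) < indicator (f a ∧ (toℕ a <ᵇ toℕ b))
    at-a rewrite fa | <⇒<ᵇ a<b | ≤⇒<ᵇ-false (≤-refl {toℕ a}) = s≤s z≤n

  rank<count : ∀ {w} → f w ≡ true → rank f w < count f
  rank<count {w} fw = sum-mono-< w (λ j → ∧-≤ (f j)) at-w
    where
    ∧-≤ : ∀ x {y} → indicator (x ∧ y) ≤ indicator x
    ∧-≤ true  {true}  = ≤-refl
    ∧-≤ true  {false} = z≤n
    ∧-≤ false         = ≤-refl
    at-w : indicator (f w ∧ (toℕ w <ᵇ toℕ w)) < indicator (f w)
    at-w rewrite fw | ≤⇒<ᵇ-false (≤-refl {toℕ w}) = s≤s z≤n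

  rank-injective : ∀ {a b} → f a ≡ true → f b ≡ true → rank f a ≡ rank f b → a ≡ b
  rank-injective {a} {b} fa fb eq with <-cmp (toℕ a) (toℕ b)
  ... | tri< a<b _ _ = ⊥-elim (<-irrefl eq (rank-mono fa a<b))
  ... | tri≈ _ a≡b _ = Finₚ.toℕ-injective a≡b
  ... | tri> _ _ b<a = ⊥-elim (<-irrefl (sym eq) (rank-mono fb b<a))

-- Bijections of Fin n

to-injective : ∀ {a b} {A : Set a} {B : Set b} (e : A ↔ B) {x y} → Inverse.to e x ≡ Inverse.to e y → x ≡ y
to-injective e = Injection.injective (↔⇒↣ e)

injective⇒surjective : ∀ {n} (h : Fin n → Fin n) → (∀ {a b} → h a ≡ h b → a ≡ b) →
                       ∀ j → Σ (Fin n) λ i → h i ≡ j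
injective⇒surjective {suc n} h h-injective j with Finₚ.any? (λ i → h i ≟ j)
... | yes hit = hit
... | no miss = ⊥-elim (<-irrefl refl (Finₚ.injective⇒≤ {f = h′} h′-injective))
  where
  h≢j : ∀ i → ¬ j ≡ h i
  h≢j i j≡hi = miss (i , sym j≡hi)
  h′ : Fin (suc n) → Fin n
  h′ i = punchOut (h≢j i)
  h′-injective : ∀ {a b} → h′ a ≡ h′ b → a ≡ b
  h′-injective = h-injective ∘ Finₚ.punchOut-injective (h≢j _) (h≢j _)

injective⇒↔ : ∀ {n m} (h : Fin n → Fin m) → (∀ {a b} → h a ≡ h b → a ≡ b) → n ≡ m →
              Σ (Fin n ↔ Fin m) λ e → ∀ i → Inverse.to e i ≡ h i
injective⇒↔ h h-injective refl =
  mk↔ₛ′ h (proj₁ ∘ onto) (proj₂ ∘ onto) (λ i → h-injective (proj₂ (onto (h i)))) , λ _ → refl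
  where
  onto : ∀ j → Σ (Fin _) λ i → h i ≡ j
  onto = injective⇒surjective h h-injective

transpose-source : ∀ {n} (a b : Fin n) → PC.transpose a b a ≡ b
transpose-source a b with a ≟ a
... | yes _   = refl
... | no a≢a = ⊥-elim (a≢a refl)

transpose-other : ∀ {n} {a b k : Fin n} → ¬ k ≡ a → ¬ k ≡ b → PC.transpose a b k ≡ k
transpose-other {a = a} {b} {k} k≢a k≢b with k ≟ a
... | yes k≡a = ⊥-elim (k≢a k≡a)
... | no _ with k ≟ b
...   | yes k≡b = ⊥-elim (k≢b k≡b)
...   | no _    = refl

extend-to-permutation : ∀ {k n} {ss ts : Vec (Fin n) k} → Unique ss → Unique ts →
                        Σ (Permutation′ n) λ π → Pointwise (λ s t → π ⟨$⟩ʳ s ≡ t) ss ts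
extend-to-permutation {ss = []}     {[]}     []          []          = Perm.id , []
extend-to-permutation {ss = s ∷ ss} {t ∷ ts} (s∉ss ∷ uss) (t∉ts ∷ uts)
  with π , π-maps ← extend-to-permutation uss uts =
  π ∘ₚ transpose (π ⟨$⟩ʳ s) t , transpose-source (π ⟨$⟩ʳ s) t ∷ still-maps s∉ss π-maps t∉ts
  where
  still-maps : ∀ {l} {ss′ ts′ : Vec (Fin _) l} → All (λ s′ → ¬ s ≡ s′) ss′ →
               Pointwise (λ s′ t′ → π ⟨$⟩ʳ s′ ≡ t′) ss′ ts′ → All (λ t′ → ¬ t ≡ t′) ts′ →
               Pointwise (λ s′ t′ → (π ∘ₚ transpose (π ⟨$⟩ʳ s) t) ⟨$⟩ʳ s′ ≡ t′) ss′ ts′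
  still-maps []             []             []             = []
  still-maps (s≢s′ ∷ s≢ss′) (πs′≡t′ ∷ maps) (t≢t′ ∷ t≢ts′) =
    trans (cong (PC.transpose (π ⟨$⟩ʳ s) t) πs′≡t′)
          (transpose-other (λ t′≡πs → s≢s′ (to-injective π (trans (sym t′≡πs) (sym πs′≡t′))))
                           (t≢t′ ∘ sym))
    ∷ still-maps s≢ss′ maps t≢ts′

∈-tabulate⁻ : ∀ {n} {f : Fin n → Bool} {i} → i ∈ tabulate f → f i ≡ true
∈-tabulate⁻ {f = f} {i} i∈ = trans (sym (lookup∘tabulate f i)) ([]=⇒lookup i∈)

∈-tabulate⁺ : ∀ {n} {f : Fin n → Bool} {i} → f i ≡ true → i ∈ tabulate f
∈-tabulate⁺ {f = f} {i} fi = lookup⇒[]= i _ (trans (lookup∘tabulate f i) fi)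

module _ {n} (G : Graph n) where

  adj⇒≢ : ∀ {a b} → adj G a b ≡ true → ¬ a ≡ b
  adj⇒≢ {a} a~b refl with () ← trans (sym a~b) (irrefl G a)

  adj-sym : ∀ {a b} → adj G a b ≡ true → adj G b a ≡ true
  adj-sym {a} {b} a~b = trans (Graph.sym G b a) a~b

  degree≡count : ∀ v → degree G v ≡ count (adj G v)
  degree≡count v = ∣tabulate∣≡count (adj G v)

  two-neighbours⇒¬leaf : ∀ {u a b} → adj G u a ≡ true → adj G u b ≡ true → ¬ a ≡ b → ¬ IsLeaf G u
  two-neighbours⇒¬leaf {u} u~a u~b a≢b leaf =
    <-irrefl (trans (sym leaf) (degree≡count u)) (count-≥2 u~a u~b a≢b)

  UniqueNeighbour : Fin n → Fin n → Set
  UniqueNeighbour v p = adj G v p ≡ true × (∀ j → adj G v j ≡ true → j ≡ p)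

  leaf-neighbour : ∀ {v} → IsLeaf G v → Σ (Fin n) (UniqueNeighbour v)
  leaf-neighbour {v} leaf with Finₚ.any? (λ j → adj G v j Boolₚ.≟ true)
  ... | yes (p , v~p) = p , v~p , only-p
    where
    only-p : ∀ j → adj G v j ≡ true → j ≡ p
    only-p j v~j with j ≟ p
    ... | yes j≡p = j≡p
    ... | no j≢p  = ⊥-elim (two-neighbours⇒¬leaf v~j v~p j≢p leaf)
  ... | no no-neighbour = ⊥-elim (0≢1+n (trans (sym (count-none isolated)) (trans (sym (degree≡count v)) leaf)))
    where
    isolated : ∀ j → adj G v j ≡ false
    isolated j with adj G v j in v~j
    ... | true  = ⊥-elim (no-neighbour (j , v~j))
    ... | false = refl

  exit-edge : ∀ {S a b} {P : Fin n → Set} → (∀ k → Dec (P k)) → Reach G S a b → P a → ¬ P b →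
              Σ (Fin n) λ c → Σ (Fin n) λ d → P c × ¬ P d × adj G c d ≡ true
  exit-edge P? (here _)                Pa ¬Pb = ⊥-elim (¬Pb Pa)
  exit-edge P? (step {a} {w} _ a~w walk) Pa ¬Pb with P? w
  ... | yes Pw  = exit-edge P? walk Pw ¬Pb
  ... | no ¬Pw = a , w , Pa , ¬Pw , a~w

  ∈-outsideN⁻ : ∀ {v j} → j ∈ outsideN G v → not (does (j ≟ v)) ∧ not (adj G v j) ≡ true
  ∈-outsideN⁻ {v} = ∈-tabulate⁻ {f = λ j → not (does (j ≟ v)) ∧ not (adj G v j)}

  module _ {v p : Fin n} (v-leaf : UniqueNeighbour v p) where

    outsideN-leaf⁻ : ∀ {j} → j ∈ outsideN G v → ¬ j ≡ v × ¬ j ≡ p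
    outsideN-leaf⁻ {j} j∈ with j ≟ v | ∈-outsideN⁻ j∈
    ... | no j≢v | v≁j = j≢v , j≢p
      where
      j≢p : ¬ j ≡ p
      j≢p refl with () ← subst (λ b → not b ≡ true) (proj₁ v-leaf) v≁j

    outsideN-leaf⁺ : ∀ {j} → ¬ j ≡ v → ¬ j ≡ p → j ∈ outsideN G v
    outsideN-leaf⁺ {j} j≢v j≢p = ∈-tabulate⁺ member
      where
      member : not (does (j ≟ v)) ∧ not (adj G v j) ≡ true
      member with j ≟ v
      ... | yes j≡v = ⊥-elim (j≢v j≡v)
      ... | no _ with adj G v j in v~j
      ...   | true  = ⊥-elim (j≢p (proj₂ v-leaf j v~j))
      ...   | false = refl

sum-list-tabulate : ∀ {m k} (f : Fin k → ℕ) (g : Fin m → Fin k) →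
                    List.sum (List.map f (List.tabulate g)) ≡ sum (λ i → f (g i))
sum-list-tabulate {zero}  f g = refl
sum-list-tabulate {suc m} f g = cong (f (g zero) +_) (sum-list-tabulate f (g ∘ suc))

module _ {n} (G : Graph n) where

  private
    _≺_ : Fin n → Fin n → Bool
    i ≺ j = toℕ i <ᵇ toℕ j

    half : ℕ
    half = sum (λ i → count (λ j → (i ≺ j) ∧ adj G i j))

    edgeCount≡half : edgeCount G ≡ half
    edgeCount≡half = trans (sum-list-tabulate (λ i → ∣ tabulate (λ j → (i ≺ j) ∧ adj G i j) ∣) (λ i → i))
                           (sum-cong-≗ (λ i → ∣tabulate∣≡count (λ j → (i ≺ j) ∧ adj G i j)))

    -- every edge is counted once from its smaller and once from its larger end
    split : ∀ i j → indicator (adj G i j) ≡ indicator ((i ≺ j) ∧ adj G i j) + indicator ((j ≺ i) ∧ adj G i j)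
    split i j with adj G i j in i~j
    ... | false rewrite ∧-zeroʳ (i ≺ j) | ∧-zeroʳ (j ≺ i) = refl
    ... | true  rewrite ∧-identityʳ (i ≺ j) | ∧-identityʳ (j ≺ i) =
      sym (trichotomy (toℕ i) (toℕ j) (adj⇒≢ G i~j ∘ Finₚ.toℕ-injective))
      where
      trichotomy : ∀ a b → ¬ a ≡ b → indicator (a <ᵇ b) + indicator (b <ᵇ a) ≡ 1
      trichotomy zero    zero    a≢b = ⊥-elim (a≢b refl)
      trichotomy zero    (suc b) _   = refl
      trichotomy (suc a) zero    _   = refl
      trichotomy (suc a) (suc b) a≢b = trichotomy a b (a≢b ∘ cong suc)

  handshake : sum (λ i → count (adj G i)) ≡ 2 * edgeCount G
  handshake = begin
    sum (λ i → count (adj G i))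
      ≡⟨ sum-cong-≗ (λ i → trans (sum-cong-≗ (split i))
                                 (∑-distrib-+ (λ j → indicator ((i ≺ j) ∧ adj G i j)) _)) ⟩
    sum (λ i → count (λ j → (i ≺ j) ∧ adj G i j) + sum (λ j → indicator ((j ≺ i) ∧ adj G i j)))
      ≡⟨ ∑-distrib-+ (λ i → count (λ j → (i ≺ j) ∧ adj G i j)) _ ⟩
    half + sum (λ i → sum (λ j → indicator ((j ≺ i) ∧ adj G i j)))
      ≡⟨ cong (half +_) (∑-comm (λ i j → indicator ((j ≺ i) ∧ adj G i j))) ⟩
    half + sum (λ j → sum (λ i → indicator ((j ≺ i) ∧ adj G i j)))
      ≡⟨ cong (half +_) (sum-cong-≗ (λ j → count-cong (λ i → cong ((j ≺ i) ∧_) (Graph.sym G i j)))) ⟩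
    half + half
      ≡⟨ cong (half +_) (sym (+-identityʳ half)) ⟩
    2 * half
      ≡⟨ cong (2 *_) (sym edgeCount≡half) ⟩
    2 * edgeCount G ∎
    where open ≡-Reasoning

CSLe-from-empty : ∀ {m n} (H : Graph m) {AH : Subset m} (G : Graph n) {AG : Subset n} →
                  (∀ i → ¬ i ∈ AH) → CSLe H AH G AG
CSLe-from-empty H      G empty k zero    a _       _ = z≤n
CSLe-from-empty H {AH} G empty k (suc b) a count-H _ with Inverse.from count-H zero
... | record { sub = S⊆AH ; conn = connected } = Irr.⊥-elim (no-member S⊆AH connected)
  where
  no-member : ∀ {S} → S ⊆ AH → ConnectedSet H S → ⊥
  no-member S⊆AH ((i , i∈S) , _) = empty i (S⊆AH i∈S)

module _ {m n} {H : Graph m} {G : Graph n} {AH : Subset m} {AG : Subset n} (π : Permutation m n)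
  (into : ∀ {i} → i ∈ AH → π ⟨$⟩ʳ i ∈ AG)
  (homomorphic : ∀ {i j} → i ∈ AH → j ∈ AH →
                 adj H i j ≡ true → adj G (π ⟨$⟩ʳ i) (π ⟨$⟩ʳ j) ≡ true)
  where

  private
    image : Subset m → Subset n
    image S = tabulate (λ j → lookup S (π ⟨$⟩ˡ j))

    ∈-image⁺ : ∀ {S i} → i ∈ S → π ⟨$⟩ʳ i ∈ image S
    ∈-image⁺ {S} {i} i∈S = ∈-tabulate⁺ (trans (cong (lookup S) (inverseˡ π)) ([]=⇒lookup i∈S))

    ∈-image⁻ : ∀ {S j} → j ∈ image S → π ⟨$⟩ˡ j ∈ S
    ∈-image⁻ {S} {j} j∈ = lookup⇒[]= (π ⟨$⟩ˡ j) S (∈-tabulate⁻ j∈)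

    ∣image∣ : ∀ S → ∣ image S ∣ ≡ ∣ S ∣
    ∣image∣ S = begin
      ∣ image S ∣                                 ≡⟨ ∣tabulate∣≡count (λ j → lookup S (π ⟨$⟩ˡ j)) ⟩
      count (λ j → lookup S (π ⟨$⟩ˡ j))           ≡⟨ ∑-permute (λ j → indicator (lookup S (π ⟨$⟩ˡ j))) π ⟩
      count (λ i → lookup S (π ⟨$⟩ˡ (π ⟨$⟩ʳ i))) ≡⟨ count-cong {g = lookup S} (cong (lookup S) ∘ λ _ → inverseˡ π) ⟩
      count (lookup S)                            ≡⟨ ∣tabulate∣≡count (lookup S) ⟨
      ∣ tabulate (lookup S) ∣                     ≡⟨ cong ∣_∣ (tabulate∘lookup S) ⟩
      ∣ S ∣                                       ∎
      where open ≡-Reasoning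

    image-injective : ∀ S T → image S ≡ image T → S ≡ T
    image-injective S T eq = begin
      S                                         ≡⟨ sym (tabulate∘lookup S) ⟩
      tabulate (lookup S)                       ≡⟨ tabulate-cong (lookup-image S) ⟩
      tabulate (λ i → lookup (image S) (π ⟨$⟩ʳ i))
        ≡⟨ cong (λ U → tabulate (λ i → lookup U (π ⟨$⟩ʳ i))) eq ⟩
      tabulate (λ i → lookup (image T) (π ⟨$⟩ʳ i)) ≡⟨ sym (tabulate-cong (lookup-image T)) ⟩
      tabulate (lookup T)                       ≡⟨ tabulate∘lookup T ⟩
      T                                         ∎
      where
      open ≡-Reasoning
      lookup-image : ∀ U i → lookup U i ≡ lookup (image U) (π ⟨$⟩ʳ i)
      lookup-image U i = sym (trans (lookup∘tabulate _ (π ⟨$⟩ʳ i)) (cong (lookup U) (inverseˡ π)))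

    reach-start : ∀ {S a b} → Reach H S a b → a ∈ S
    reach-start (here a∈S)     = a∈S
    reach-start (step a∈S _ _) = a∈S

    reach-image : ∀ {S} → S ⊆ AH → ∀ {a b} → Reach H S a b → Reach G (image S) (π ⟨$⟩ʳ a) (π ⟨$⟩ʳ b)
    reach-image S⊆AH (here a∈S)          = here (∈-image⁺ a∈S)
    reach-image S⊆AH (step a∈S a~w walk) =
      step (∈-image⁺ a∈S) (homomorphic (S⊆AH a∈S) (S⊆AH (reach-start walk)) a~w) (reach-image S⊆AH walk)

    connected-image : ∀ {S} → S ⊆ AH → ConnectedSet H S → ConnectedSet G (image S)
    connected-image {S} S⊆AH ((i , i∈S) , connected) = (π ⟨$⟩ʳ i , ∈-image⁺ i∈S) , λ a b a∈ b∈ →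
      subst₂ (Reach G (image S)) (inverseʳ π) (inverseʳ π)
             (reach-image S⊆AH (connected _ _ (∈-image⁻ a∈) (∈-image⁻ b∈)))

    image-⊆ : ∀ {S} → S ⊆ AH → image S ⊆ AG
    image-⊆ S⊆AH j∈ = subst (_∈ AG) (inverseʳ π) (into (S⊆AH (∈-image⁻ j∈)))

    map-ConnSet : ∀ {k} → ConnSet H AH k → ConnSet G AG k
    map-ConnSet record { set = S ; sub = S⊆AH ; conn = connected ; size = size } = record
      { set = image S ; sub = image-⊆ S⊆AH ; conn = connected-image S⊆AH connected
      ; size = trans (∣image∣ S) size }

    ConnSet-≡ : ∀ {k} {C D : ConnSet H AH k} → ConnSet.set C ≡ ConnSet.set D → C ≡ D
    ConnSet-≡ {C = record { set = S }} {record { set = .S }} refl = refl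

    map-ConnSet-injective : ∀ {k} {C D : ConnSet H AH k} → map-ConnSet C ≡ map-ConnSet D → C ≡ D
    map-ConnSet-injective eq = ConnSet-≡ (image-injective _ _ (cong ConnSet.set eq))

  CSLe-by-embedding : CSLe H AH G AG
  CSLe-by-embedding k b a count-H count-G = Finₚ.injective⇒≤ {f = embed} embed-injective
    where
    embed : Fin b → Fin a
    embed i = Inverse.to count-G (map-ConnSet (Inverse.from count-H i))
    embed-injective : ∀ {i j} → embed i ≡ embed j → i ≡ j
    embed-injective = to-injective (↔-sym count-H) ∘ map-ConnSet-injective ∘ to-injective count-G

record Path₃ {n} (G : Graph n) (A : Subset n) : Set where
  field
    {x y z}  : Fin n
    x∈A      : x ∈ A
    y∈A      : y ∈ A
    z∈A      : z ∈ A
    y~x      : adj G y x ≡ true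
    y~z      : adj G y z ≡ true
    x≢z      : ¬ x ≡ z

MaxDegree≤1 : ∀ {n} → Graph n → Subset n → Set
MaxDegree≤1 {n} G A = ∀ {x y z : Fin n} → x ∈ A → y ∈ A → z ∈ A →
                     adj G y x ≡ true → adj G y z ≡ true → x ≡ z

path₃-or-maxDegree≤1 : ∀ {n} (G : Graph n) (A : Subset n) → Path₃ G A ⊎ MaxDegree≤1 G A
path₃-or-maxDegree≤1 G A with Finₚ.any? (λ x → Finₚ.any? (λ y → Finₚ.any? (λ z → path? x y z)))
  where
  path? : ∀ x y z → Dec (x ∈ A × y ∈ A × z ∈ A × adj G y x ≡ true × adj G y z ≡ true × ¬ x ≡ z)
  path? x y z = x ∈? A ×-dec y ∈? A ×-dec z ∈? A
              ×-dec adj G y x Boolₚ.≟ true ×-dec adj G y z Boolₚ.≟ true ×-dec ¬? (x ≟ z)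
... | yes (_ , _ , _ , x∈A , y∈A , z∈A , y~x , y~z , x≢z) = inj₁ (record
  { x∈A = x∈A ; y∈A = y∈A ; z∈A = z∈A ; y~x = y~x ; y~z = y~z ; x≢z = x≢z })
... | no no-path = inj₂ λ {x} {y} {z} x∈A y∈A z∈A y~x y~z → decidable-stable (x ≟ z)
  λ x≢z → no-path (x , y , z , x∈A , y∈A , z∈A , y~x , y~z , x≢z)

-- The graph B_n

data LeafOfB : ∀ n → Fin n → Set where
  order-two : ∀ {u} → LeafOfB 2 u
  further   : ∀ {m} {u : Fin (4 + m)} → 4 ≤ toℕ u → LeafOfB (4 + m) u

B-leaf : ∀ {n} {u : Fin n} → IsLeaf (B n) u → LeafOfB n u
B-leaf {1}                 {0F} ()
B-leaf {2}                       _    = order-two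
B-leaf {n@(suc (suc (suc _)))} {0F} leaf = ⊥-elim (two-neighbours⇒¬leaf (B n) {0F} {1F} {2F} refl refl (λ ()) leaf)
B-leaf {n@(suc (suc (suc _)))} {1F} leaf = ⊥-elim (two-neighbours⇒¬leaf (B n) {1F} {0F} {2F} refl refl (λ ()) leaf)
B-leaf {n@(suc (suc (suc _)))} {2F} leaf = ⊥-elim (two-neighbours⇒¬leaf (B n) {2F} {0F} {1F} refl refl (λ ()) leaf)
B-leaf {n@(suc (suc (suc (suc _))))} {3F} leaf = ⊥-elim (two-neighbours⇒¬leaf (B n) {3F} {0F} {1F} refl refl (λ ()) leaf)
B-leaf {suc (suc (suc (suc _)))} {suc (suc (suc (suc _)))} _ = further (s≤s (s≤s (s≤s (s≤s z≤n))))

outsideN-B₂-empty : ∀ u i → ¬ i ∈ outsideN (B 2) u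
outsideN-B₂-empty u@0F 0F i∈ with () ← ∈-outsideN⁻ (B 2) {v = u} i∈
outsideN-B₂-empty u@0F 1F i∈ with () ← ∈-outsideN⁻ (B 2) {v = u} i∈
outsideN-B₂-empty u@1F 0F i∈ with () ← ∈-outsideN⁻ (B 2) {v = u} i∈
outsideN-B₂-empty u@1F 1F i∈ with () ← ∈-outsideN⁻ (B 2) {v = u} i∈

module _ {m : ℕ} where

  B-pendant : ∀ {u : Fin (4 + m)} → 4 ≤ toℕ u → UniqueNeighbour (B (4 + m)) u 0F
  B-pendant {0F} ()
  B-pendant {1F} (s≤s ())
  B-pendant {2F} (s≤s (s≤s ()))
  B-pendant {3F} (s≤s (s≤s (s≤s ())))
  B-pendant {u@(suc (suc (suc (suc _))))} _ = refl , only-centre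
    where
    only-centre : ∀ j → adj (B (4 + m)) u j ≡ true → j ≡ 0F
    only-centre 0F               _  = refl
    only-centre 1F               ()
    only-centre (suc (suc _))    u~j with () ← trans (sym u~j) (∧-zeroʳ _)

  outsideN-B⁻ : ∀ {u j : Fin (4 + m)} → 4 ≤ toℕ u → j ∈ outsideN (B (4 + m)) u → ¬ j ≡ u × ¬ j ≡ 0F
  outsideN-B⁻ 4≤u = outsideN-leaf⁻ (B (4 + m)) (B-pendant 4≤u)

  B-edge-off-centre : ∀ {i j : Fin (4 + m)} → ¬ i ≡ 0F → ¬ j ≡ 0F → adj (B (4 + m)) i j ≡ true →
                      (i ≡ 1F × (j ≡ 2F ⊎ j ≡ 3F)) ⊎ (j ≡ 1F × (i ≡ 2F ⊎ i ≡ 3F))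
  B-edge-off-centre {0F} i≢0 _   _ = ⊥-elim (i≢0 refl)
  B-edge-off-centre {_} {0F} _ j≢0 _ = ⊥-elim (j≢0 refl)
  B-edge-off-centre {1F} {2F} _ _ _ = inj₁ (refl , inj₁ refl)
  B-edge-off-centre {1F} {3F} _ _ _ = inj₁ (refl , inj₂ refl)
  B-edge-off-centre {2F} {1F} _ _ _ = inj₂ (refl , inj₁ refl)
  B-edge-off-centre {3F} {1F} _ _ _ = inj₂ (refl , inj₂ refl)
  B-edge-off-centre {1F} {1F} _ _ ()
  B-edge-off-centre {1F} {suc (suc (suc (suc _)))} _ _ ()
  B-edge-off-centre {2F} {2F} _ _ ()
  B-edge-off-centre {2F} {3F} _ _ ()
  B-edge-off-centre {2F} {suc (suc (suc (suc _)))} _ _ ()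
  B-edge-off-centre {3F} {2F} _ _ ()
  B-edge-off-centre {3F} {3F} _ _ ()
  B-edge-off-centre {3F} {suc (suc (suc (suc _)))} _ _ ()
  B-edge-off-centre {suc (suc (suc (suc _)))} {1F} _ _ ()
  B-edge-off-centre {suc (suc (suc (suc _)))} {suc (suc _)} _ _ i~j with () ← trans (sym i~j) (∧-zeroʳ _)

module _ {m} (G : Graph (4 + m)) {v p u : Fin (4 + m)} (v-leaf : UniqueNeighbour G v p) (4≤u : 4 ≤ toℕ u)
         (path : Path₃ G (outsideN G v)) where

  open Path₃ path

  private
    v≢ : ∀ {j} → j ∈ outsideN G v → ¬ v ≡ j
    v≢ j∈ = proj₁ (outsideN-leaf⁻ G v-leaf j∈) ∘ sym

    p≢ : ∀ {j} → j ∈ outsideN G v → ¬ p ≡ j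
    p≢ j∈ = proj₂ (outsideN-leaf⁻ G v-leaf j∈) ∘ sym

    u≢ : ∀ c → toℕ c < 4 → ¬ u ≡ c
    u≢ c c<4 refl = <-irrefl refl (<-≤-trans c<4 4≤u)

    -- B_n - N[u] is the path b a w, i.e. 2 1 3, plus isolated vertices; it is sent onto x y z,
    -- while the centre c = 0 of B_n goes to p and u goes to v.
    sources : Vec (Fin (4 + m)) 5
    sources = 0F ∷ u ∷ 1F ∷ 2F ∷ 3F ∷ []

    targets : Vec (Fin (4 + m)) 5
    targets = p ∷ v ∷ y ∷ x ∷ z ∷ []

    sources-distinct : Unique sources
    sources-distinct = (u≢ 0F (s≤s z≤n) ∘ sym ∷ (λ ()) ∷ (λ ()) ∷ (λ ()) ∷ [])
                     ∷ (u≢ 1F (s≤s (s≤s z≤n)) ∷ u≢ 2F (s≤s (s≤s (s≤s z≤n)))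
                        ∷ u≢ 3F (s≤s (s≤s (s≤s (s≤s z≤n)))) ∷ [])
                     ∷ ((λ ()) ∷ (λ ()) ∷ []) ∷ ((λ ()) ∷ []) ∷ [] ∷ []

    targets-distinct : Unique targets
    targets-distinct = (adj⇒≢ G (proj₁ v-leaf) ∘ sym ∷ p≢ y∈A ∷ p≢ x∈A ∷ p≢ z∈A ∷ [])
                     ∷ (v≢ y∈A ∷ v≢ x∈A ∷ v≢ z∈A ∷ [])
                     ∷ (adj⇒≢ G y~x ∷ adj⇒≢ G y~z ∷ []) ∷ (x≢z ∷ []) ∷ [] ∷ []

    module _ (π : Permutation′ (4 + m)) (π-maps : Pointwise (λ s t → π ⟨$⟩ʳ s ≡ t) sources targets) where

      maps : ∀ k → π ⟨$⟩ʳ lookup sources k ≡ lookup targets k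
      maps = Pointwise.lookup π-maps

      into : ∀ {i} → i ∈ outsideN (B (4 + m)) u → π ⟨$⟩ʳ i ∈ outsideN G v
      into i∈ = outsideN-leaf⁺ G v-leaf
        (λ πi≡v → proj₁ (outsideN-B⁻ 4≤u i∈) (to-injective π (trans πi≡v (sym (maps 1F)))))
        (λ πi≡p → proj₂ (outsideN-B⁻ 4≤u i∈) (to-injective π (trans πi≡p (sym (maps 0F)))))

      edge : ∀ {i j a b} → π ⟨$⟩ʳ i ≡ a → π ⟨$⟩ʳ j ≡ b →
             adj G a b ≡ true → adj G (π ⟨$⟩ʳ i) (π ⟨$⟩ʳ j) ≡ true
      edge refl refl a~b = a~b

      homomorphic : ∀ {i j} → i ∈ outsideN (B (4 + m)) u → j ∈ outsideN (B (4 + m)) u →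
                    adj (B (4 + m)) i j ≡ true → adj G (π ⟨$⟩ʳ i) (π ⟨$⟩ʳ j) ≡ true
      homomorphic i∈ j∈ i~j
        with B-edge-off-centre (proj₂ (outsideN-B⁻ 4≤u i∈)) (proj₂ (outsideN-B⁻ 4≤u j∈)) i~j
      ... | inj₁ (refl , inj₁ refl) = edge (maps 2F) (maps 3F) y~x
      ... | inj₁ (refl , inj₂ refl) = edge (maps 2F) (maps 4F) y~z
      ... | inj₂ (refl , inj₁ refl) = edge (maps 3F) (maps 2F) (adj-sym G y~x)
      ... | inj₂ (refl , inj₂ refl) = edge (maps 4F) (maps 2F) (adj-sym G y~z)

  CSLe-from-path₃ : CSLe (B (4 + m)) (outsideN (B (4 + m)) u) G (outsideN G v)
  CSLe-from-path₃ = uncurry embedding (extend-to-permutation sources-distinct targets-distinct)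
    where
    embedding : (π : Permutation′ (4 + m)) → Pointwise (λ s t → π ⟨$⟩ʳ s ≡ t) sources targets →
                CSLe (B (4 + m)) (outsideN (B (4 + m)) u) G (outsideN G v)
    embedding π π-maps = CSLe-by-embedding π (into π π-maps) (homomorphic π π-maps)

-- The graph F(n₁,n₂)

isEven-double : ∀ r → isEven (2 * r) ≡ true
isEven-double zero    = refl
isEven-double (suc r) = subst (λ k → isEven k ≡ true) (sym (*-suc 2 r)) (isEven-double r)

isEven-double+1 : ∀ r → isEven (suc (2 * r)) ≡ false
isEven-double+1 zero    = refl
isEven-double+1 (suc r) = subst (λ k → isEven (suc k) ≡ false) (sym (*-suc 2 r)) (isEven-double+1 r)

-- The vertices of F(n₁,n₂): the triangles are indexed by r < 2 and a side, the
-- pendant paths z x_r y_r by r < n₂.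
data FVertex : Set where
  centre   : FVertex
  triangle : ℕ → Bool → FVertex
  leaf     : ℕ → FVertex
  inner    : ℕ → FVertex
  outer    : ℕ → FVertex

arc : FVertex → FVertex → Bool
arc centre               (triangle _ _)      = true
arc centre               (leaf _)            = true
arc centre               (inner _)           = true
arc (triangle r false)   (triangle r′ true)  = r ≡ᵇ r′
arc (inner r)            (outer r′)          = r ≡ᵇ r′
arc _                    _                   = false

F-adj : FVertex → FVertex → Bool
F-adj a b = arc a b ∨ arc b a

module FLabels (n₁ n₂ : ℕ) where

  encode : FVertex → ℕ
  encode centre             = 0
  encode (triangle r false) = 1 + 2 * r
  encode (triangle r true)  = 2 + 2 * r
  encode (leaf r)           = 5 + r
  encode (inner r)          = 5 + (n₁ + 2 * r)
  encode (outer r)          = 6 + (n₁ + 2 * r)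

  InRange : FVertex → Set
  InRange centre         = ⊤
  InRange (triangle r _) = r < 2
  InRange (leaf r)       = r < n₁
  InRange (inner r)      = r < n₂
  InRange (outer r)      = r < n₂

  private
    ≡ᵇ-shift : ∀ r′ r → ((n₁ + 2 * r′) ≡ᵇ (n₁ + 2 * r)) ≡ (r ≡ᵇ r′)
    ≡ᵇ-shift r′ r with r ℕₚ.≟ r′
    ... | yes refl = trans (≡ᵇ-refl (n₁ + 2 * r)) (sym (≡ᵇ-refl r))
    ... | no r≢r′  = trans (≢⇒≡ᵇ-false (r≢r′ ∘ sym ∘ *-cancelˡ-≡ r′ r 2 ∘ +-cancelˡ-≡ n₁ _ _))
                           (sym (≢⇒≡ᵇ-false r≢r′))

    n₁≤x : ∀ r → n₁ ≤ n₁ + 2 * r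
    n₁≤x r = m≤m+n n₁ (2 * r)

    n₁≤y : ∀ r → n₁ ≤ suc (n₁ + 2 * r)
    n₁≤y r = m≤n⇒m≤1+n (n₁≤x r)

  fCode-encode : ∀ a b → InRange a → InRange b → fCode n₁ (encode a) (encode b) ≡ arc a b
  fCode-encode centre centre _ _ = refl
  fCode-encode centre (triangle 0 false) _ _ = refl
  fCode-encode centre (triangle 0 true)  _ _ = refl
  fCode-encode centre (triangle 1 false) _ _ = refl
  fCode-encode centre (triangle 1 true)  _ _ = refl
  fCode-encode centre (triangle (suc (suc _)) _) _ (s≤s (s≤s ()))
  fCode-encode centre (leaf r) _ r<n₁ rewrite <⇒<ᵇ r<n₁ = refl
  fCode-encode centre (inner r) _ _
    rewrite ≤⇒<ᵇ-false (n₁≤x r) | <⇒<ᵇ (s≤s (n₁≤x r)) | m+n∸m≡n n₁ (2 * r) | isEven-double r = refl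
  fCode-encode centre (outer r) _ _
    rewrite ≤⇒<ᵇ-false (n₁≤y r) | <⇒<ᵇ (s≤s (n₁≤y r)) | m+1+n∸m≡1+n n₁ (2 * r) | isEven-double+1 r = refl
  fCode-encode (triangle 0 false) centre             _ _ = refl
  fCode-encode (triangle 0 false) (triangle 0 false) _ _ = refl
  fCode-encode (triangle 0 false) (triangle 0 true)  _ _ = refl
  fCode-encode (triangle 0 false) (triangle 1 false) _ _ = refl
  fCode-encode (triangle 0 false) (triangle 1 true)  _ _ = refl
  fCode-encode (triangle 0 false) (leaf _)           _ _ = refl
  fCode-encode (triangle 0 false) (inner _)          _ _ = refl
  fCode-encode (triangle 0 false) (outer _)          _ _ = refl
  fCode-encode (triangle 0 true)  centre             _ _ = refl
  fCode-encode (triangle 0 true)  (triangle 0 false) _ _ = refl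
  fCode-encode (triangle 0 true)  (triangle 0 true)  _ _ = refl
  fCode-encode (triangle 0 true)  (triangle 1 false) _ _ = refl
  fCode-encode (triangle 0 true)  (triangle 1 true)  _ _ = refl
  fCode-encode (triangle 0 true)  (leaf _)           _ _ = refl
  fCode-encode (triangle 0 true)  (inner _)          _ _ = refl
  fCode-encode (triangle 0 true)  (outer _)          _ _ = refl
  fCode-encode (triangle 1 false) centre             _ _ = refl
  fCode-encode (triangle 1 false) (triangle 0 false) _ _ = refl
  fCode-encode (triangle 1 false) (triangle 0 true)  _ _ = refl
  fCode-encode (triangle 1 false) (triangle 1 false) _ _ = refl
  fCode-encode (triangle 1 false) (triangle 1 true)  _ _ = refl
  fCode-encode (triangle 1 false) (leaf _)           _ _ = refl
  fCode-encode (triangle 1 false) (inner _)          _ _ = refl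
  fCode-encode (triangle 1 false) (outer _)          _ _ = refl
  fCode-encode (triangle 1 true)  centre             _ _ = refl
  fCode-encode (triangle 1 true)  (triangle 0 false) _ _ = refl
  fCode-encode (triangle 1 true)  (triangle 0 true)  _ _ = refl
  fCode-encode (triangle 1 true)  (triangle 1 false) _ _ = refl
  fCode-encode (triangle 1 true)  (triangle 1 true)  _ _ = refl
  fCode-encode (triangle 1 true)  (leaf _)           _ _ = refl
  fCode-encode (triangle 1 true)  (inner _)          _ _ = refl
  fCode-encode (triangle 1 true)  (outer _)          _ _ = refl
  fCode-encode (triangle _ _) (triangle (suc (suc _)) _) _ (s≤s (s≤s ()))
  fCode-encode (triangle (suc (suc _)) _) _ (s≤s (s≤s ())) _
  fCode-encode (leaf r) _ r<n₁ _ rewrite ≤⇒<ᵇ-false r<n₁ = refl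
  fCode-encode (inner r) b _ b-in
    rewrite <⇒<ᵇ (s≤s (n₁≤x r)) | m+n∸m≡n n₁ (2 * r) | isEven-double r = to-outer b b-in
    where
    to-outer : ∀ b → InRange b → (encode b ≡ᵇ 6 + (n₁ + 2 * r)) ≡ arc (inner r) b
    to-outer centre             _ = refl
    to-outer (triangle 0 false) _ = refl
    to-outer (triangle 0 true)  _ = refl
    to-outer (triangle 1 false) _ = refl
    to-outer (triangle 1 true)  _ = refl
    to-outer (triangle (suc (suc _)) _) (s≤s (s≤s ()))
    to-outer (leaf r′) r′<n₁ = ≢⇒≡ᵇ-false (λ eq → <-irrefl eq (<-≤-trans r′<n₁ (n₁≤y r)))
    to-outer (inner r′) _    = ≢⇒≡ᵇ-false (even≢odd r′ r ∘ +-cancelˡ-≡ n₁ _ _ ∘ flip trans (sym (+-suc n₁ (2 * r))))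
    to-outer (outer r′) _    = ≡ᵇ-shift r′ r
  fCode-encode (outer r) _ _ _
    rewrite <⇒<ᵇ (s≤s (n₁≤y r)) | m+1+n∸m≡1+n n₁ (2 * r) | isEven-double+1 r = refl

  private
    pathVertex : ℕ → FVertex
    pathVertex d = if isEven d then inner ⌊ d /2⌋ else outer ⌊ d /2⌋

    ⌊2*r/2⌋ : ∀ r → ⌊ 2 * r /2⌋ ≡ r
    ⌊2*r/2⌋ zero    = refl
    ⌊2*r/2⌋ (suc r) = subst (λ k → ⌊ k /2⌋ ≡ suc r) (sym (*-suc 2 r)) (cong suc (⌊2*r/2⌋ r))

    ⌊1+2*r/2⌋ : ∀ r → ⌊ suc (2 * r) /2⌋ ≡ r
    ⌊1+2*r/2⌋ zero    = refl
    ⌊1+2*r/2⌋ (suc r) = subst (λ k → ⌊ suc k /2⌋ ≡ suc r) (sym (*-suc 2 r)) (cong suc (⌊1+2*r/2⌋ r))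

    decode : ℕ → FVertex
    decode 0 = centre
    decode 1 = triangle 0 false
    decode 2 = triangle 0 true
    decode 3 = triangle 1 false
    decode 4 = triangle 1 true
    decode (suc (suc (suc (suc (suc k))))) = if k <ᵇ n₁ then leaf k else pathVertex (k ∸ n₁)

    decode-encode : ∀ a → InRange a → decode (encode a) ≡ a
    decode-encode centre                   _ = refl
    decode-encode (triangle 0 false)       _ = refl
    decode-encode (triangle 0 true)        _ = refl
    decode-encode (triangle 1 false)       _ = refl
    decode-encode (triangle 1 true)        _ = refl
    decode-encode (triangle (suc (suc _)) _) (s≤s (s≤s ()))
    decode-encode (leaf r)  r<n₁ rewrite <⇒<ᵇ r<n₁ = refl
    decode-encode (inner r) _
      rewrite ≤⇒<ᵇ-false (n₁≤x r) | m+n∸m≡n n₁ (2 * r) | isEven-double r | ⌊2*r/2⌋ r = refl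
    decode-encode (outer r) _
      rewrite ≤⇒<ᵇ-false (n₁≤y r) | m+1+n∸m≡1+n n₁ (2 * r) | isEven-double+1 r | ⌊1+2*r/2⌋ r = refl

  encode-injective : ∀ {a b} → InRange a → InRange b → encode a ≡ encode b → a ≡ b
  encode-injective {a} {b} a-in b-in eq =
    trans (sym (decode-encode a a-in)) (trans (cong decode eq) (decode-encode b b-in))

  arc-irreflexive : ∀ a → arc a a ≡ false
  arc-irreflexive centre             = refl
  arc-irreflexive (triangle _ false) = refl
  arc-irreflexive (triangle _ true)  = refl
  arc-irreflexive (leaf _)           = refl
  arc-irreflexive (inner _)          = refl
  arc-irreflexive (outer _)          = refl

  adj-code : ℕ → ℕ → Bool
  adj-code a b = not (a ≡ᵇ b) ∧ (fCode n₁ a b ∨ fCode n₁ b a)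

  adj-code-encode : ∀ {a b} → InRange a → InRange b → adj-code (encode a) (encode b) ≡ F-adj a b
  adj-code-encode {a} {b} a-in b-in rewrite fCode-encode a b a-in b-in | fCode-encode b a b-in a-in
    with F-adj a b in a~b
  ... | false = ∧-zeroʳ _
  ... | true  = cong (λ e → not e ∧ true) (≢⇒≡ᵇ-false (a≢b ∘ encode-injective a-in b-in))
    where
    a≢b : ¬ a ≡ b
    a≢b refl with () ← trans (sym a~b) (cong₂ _∨_ (arc-irreflexive a) (arc-irreflexive a))

  order : ℕ
  order = 5 + n₁ + 2 * n₂

  encode<order : ∀ a → InRange a → encode a < order
  encode<order centre             _ = s≤s z≤n
  encode<order (triangle 0 false) _ = s≤s (s≤s z≤n)
  encode<order (triangle 0 true)  _ = s≤s (s≤s (s≤s z≤n))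
  encode<order (triangle 1 false) _ = s≤s (s≤s (s≤s (s≤s z≤n)))
  encode<order (triangle 1 true)  _ = s≤s (s≤s (s≤s (s≤s (s≤s z≤n))))
  encode<order (triangle (suc (suc _)) _) (s≤s (s≤s ()))
  encode<order (leaf r)  r<n₁ = +-monoʳ-< 5 (<-≤-trans r<n₁ (m≤m+n n₁ _))
  encode<order (inner r) r<n₂ = +-monoʳ-< 5 (+-monoʳ-< n₁ (*-monoʳ-< 2 r<n₂))
  encode<order (outer r) r<n₂ = +-monoʳ-≤ 5 (begin
    2 + (n₁ + 2 * r) ≡⟨ sym (trans (+-suc n₁ _) (cong suc (+-suc n₁ _))) ⟩
    n₁ + (2 + 2 * r) ≡⟨ cong (n₁ +_) (sym (*-suc 2 r)) ⟩
    n₁ + 2 * suc r   ≤⟨ +-monoʳ-≤ n₁ (*-monoʳ-≤ 2 r<n₂) ⟩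
    n₁ + 2 * n₂      ∎)
    where open ≤-Reasoning

-- Recognising F(n₁,n₂)

-- The part a vertex will play in F(n₁,n₂): z, a pendant leaf, a_i, b_i, x_i or y_i.
-- Taking Fin 6 rather than a data type lets sum-by-fibres sort sums by role.
Role : Set
Role = Fin 6

pattern centreᴿ    = 0F
pattern leafᴿ      = 1F
pattern triangle₁ᴿ = 2F
pattern triangle₂ᴿ = 3F
pattern innerᴿ     = 4F
pattern outerᴿ     = 5F

-- The role of a vertex w ∉ N[v] matched to j, from whether w and j are adjacent to p;
-- the two ends of a triangle are told apart by their order. (The last case cannot occur.)
pairRole : Bool → Bool → Bool → Role
pairRole true  true  true  = triangle₁ᴿ
pairRole true  true  false = triangle₂ᴿ
pairRole true  false _     = innerᴿ
pairRole false true  _     = outerᴿ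
pairRole false false _     = leafᴿ

swapRole : Role → Role
swapRole centreᴿ    = centreᴿ
swapRole leafᴿ      = leafᴿ
swapRole triangle₁ᴿ = triangle₂ᴿ
swapRole triangle₂ᴿ = triangle₁ᴿ
swapRole innerᴿ     = outerᴿ
swapRole outerᴿ     = innerᴿ

swapRole-involutive : ∀ r → swapRole (swapRole r) ≡ r
swapRole-involutive centreᴿ    = refl
swapRole-involutive leafᴿ      = refl
swapRole-involutive triangle₁ᴿ = refl
swapRole-involutive triangle₂ᴿ = refl
swapRole-involutive innerᴿ     = refl
swapRole-involutive outerᴿ     = refl

-- Vertex count, degree of the centre and the degree sum, sorted by role (as produced
-- by sum-by-fibres), together with the handshake lemma force exactly two triangles.
two-triangles : ∀ {n c l t₁ t₂ x y d} → c ≡ 1 → t₂ ≡ t₁ → y ≡ x →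
                n ≡ 1 * c + (1 * l + (1 * t₁ + (1 * t₂ + (1 * x + (1 * y + 0))))) →
                d ≡ 0 * c + (1 * l + (1 * t₁ + (1 * t₂ + (1 * x + (0 * y + 0))))) →
                d * c + (1 * l + (2 * t₁ + (2 * t₂ + (2 * x + (1 * y + 0))))) ≡ 2 * (n + 1) →
                t₁ ≡ 2 × l + 2 * x + 5 ≡ n
two-triangles {l = l} {t} {x = x} refl refl refl refl refl handshake = t≡2 , order≡
  where
  open +-*-Solver
  K : ℕ
  K = 2 * l + 4 * t + 4 * x
  degrees≡ : (0 * 1 + (1 * l + (1 * t + (1 * t + (1 * x + (0 * x + 0)))))) * 1
             + (1 * l + (2 * t + (2 * t + (2 * x + (1 * x + 0))))) ≡ 2 * t + K
  degrees≡ = solve 3 (λ l t x →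
    (con 0 :* con 1 :+ (con 1 :* l :+ (con 1 :* t :+ (con 1 :* t :+ (con 1 :* x :+ (con 0 :* x :+ con 0)))))) :* con 1
    :+ (con 1 :* l :+ (con 2 :* t :+ (con 2 :* t :+ (con 2 :* x :+ (con 1 :* x :+ con 0)))))
    := con 2 :* t :+ (con 2 :* l :+ con 4 :* t :+ con 4 :* x)) refl l t x
  edges≡ : 2 * (1 * 1 + (1 * l + (1 * t + (1 * t + (1 * x + (1 * x + 0))))) + 1) ≡ 4 + K
  edges≡ = solve 3 (λ l t x →
    con 2 :* (con 1 :* con 1 :+ (con 1 :* l :+ (con 1 :* t :+ (con 1 :* t :+ (con 1 :* x :+ (con 1 :* x :+ con 0))))) :+ con 1)
    := con 4 :+ (con 2 :* l :+ con 4 :* t :+ con 4 :* x)) refl l t x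
  t≡2 : t ≡ 2
  t≡2 = *-cancelˡ-≡ t 2 2 (+-cancelʳ-≡ K (2 * t) 4 (trans (sym degrees≡) (trans handshake edges≡)))
  order≡ : l + 2 * x + 5 ≡ 1 * 1 + (1 * l + (1 * t + (1 * t + (1 * x + (1 * x + 0)))))
  order≡ rewrite t≡2 = solve 2 (λ l x → l :+ con 2 :* x :+ con 5
    := con 1 :* con 1 :+ (con 1 :* l :+ (con 1 :* con 2 :+ (con 1 :* con 2 :+ (con 1 :* x :+ (con 1 :* x :+ con 0)))))) refl l x

module Recognition {n} (G : Graph n) (bicyclic : Bicyclic G) {v p : Fin n}
  (v-leaf : UniqueNeighbour G v p) (max≤1 : MaxDegree≤1 G (outsideN G v)) where

  A : Subset n
  A = outsideN G v

  private
    only-p : ∀ j → adj G v j ≡ true → j ≡ p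
    only-p = proj₂ v-leaf

    ∈A⇒≢p : ∀ {j} → j ∈ A → ¬ j ≡ p
    ∈A⇒≢p = proj₂ ∘ outsideN-leaf⁻ G v-leaf

    ≁v : ∀ {w} → ¬ w ≡ p → adj G w v ≡ false
    ≁v {w} w≢p = Boolₚ.¬-not (w≢p ∘ only-p w ∘ adj-sym G)

    reach : ∀ a b → Reach G Sub.⊤ a b
    reach a b = proj₂ (proj₁ bicyclic) a b ∈⊤ ∈⊤

    neighbour-in-A? : ∀ w → (Σ (Fin n) λ j → j ∈ A × adj G w j ≡ true) ⊎
                            (∀ j → j ∈ A → adj G w j ≡ false)
    neighbour-in-A? w with Finₚ.any? (λ j → j ∈? A ×-dec adj G w j Boolₚ.≟ true)
    ... | yes hit  = inj₁ hit
    ... | no none = inj₂ λ j j∈A → Boolₚ.¬-not (λ w~j → none (j , j∈A , w~j))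

    only-p⇒adj-p : ∀ {w} → ¬ w ≡ p → (∀ k → adj G w k ≡ true → k ≡ p) → adj G w p ≡ true
    only-p⇒adj-p {w} w≢p only
      with c , d , refl , d≢w , c~d ← exit-edge G (_≟ w) (reach w p) refl (w≢p ∘ sym)
      = subst (λ k → adj G w k ≡ true) (only d c~d) c~d

    matched-neighbours : ∀ {w j} → w ∈ A → j ∈ A → adj G w j ≡ true →
                         ∀ k → adj G w k ≡ true → k ≡ j ⊎ k ≡ p
    matched-neighbours {w} {j} w∈A j∈A w~j k w~k with k ≟ p | k ≟ v
    ... | yes k≡p | _        = inj₂ k≡p
    ... | no _    | yes refl = ⊥-elim (Boolₚ.not-¬ w~k (≁v (∈A⇒≢p w∈A)))
    ... | no k≢p  | no k≢v   = inj₁ (max≤1 (outsideN-leaf⁺ G v-leaf k≢v k≢p) w∈A j∈A w~k w~j)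

    -- A walk from w to p leaves {w, j}, and only through an edge to p.
    matched-spoke : ∀ {w j} → w ∈ A → j ∈ A → adj G w j ≡ true → (adj G w p ∨ adj G j p) ≡ true
    matched-spoke {w} {j} w∈A j∈A w~j
      with exit-edge G (λ k → k ≟ w ⊎-dec k ≟ j) (reach w p) (inj₁ refl)
                       (Sum.[ ∈A⇒≢p w∈A ∘ sym , ∈A⇒≢p j∈A ∘ sym ])
    ... | c , d , inj₁ refl , d∉wj , c~d with matched-neighbours w∈A j∈A w~j d c~d
    ...   | inj₁ d≡j  = ⊥-elim (d∉wj (inj₂ d≡j))
    ...   | inj₂ refl = cong (_∨ adj G j p) c~d
    matched-spoke {w} {j} w∈A j∈A w~j
        | c , d , inj₂ refl , d∉wj , c~d with matched-neighbours j∈A w∈A (adj-sym G w~j) d c~d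
    ...   | inj₁ d≡w  = ⊥-elim (d∉wj (inj₁ d≡w))
    ...   | inj₂ refl = trans (cong (adj G w p ∨_) c~d) (∨-zeroʳ _)

  data Kind (w : Fin n) : Set where
    hub     : w ≡ p → Kind w
    pendant : ¬ w ≡ p → adj G w p ≡ true → (∀ k → adj G w k ≡ true → k ≡ p) → Kind w
    matched : ∀ j → w ∈ A → j ∈ A → adj G w j ≡ true → Kind w

  -- Opaque: role w and mate w then stay stuck on kind w, so that `with kind w` analyses them
  -- and unification can still recover w from them.
  opaque
    kind : ∀ w → Kind w
    kind w with w ≟ p
    ... | yes w≡p = hub w≡p
    ... | no w≢p with neighbour-in-A? w
    ...   | inj₁ (j , j∈A , w~j) = matched j (outsideN-leaf⁺ G v-leaf w≢v w≢p) j∈A w~j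
      where
      w≢v : ¬ w ≡ v
      w≢v refl = ∈A⇒≢p j∈A (only-p j w~j)
    ...   | inj₂ none = pendant w≢p (only-p⇒adj-p w≢p only) only
      where
      only : ∀ k → adj G w k ≡ true → k ≡ p
      only k w~k with k ≟ p | k ≟ v
      ... | yes k≡p | _        = k≡p
      ... | no _    | yes refl = ⊥-elim (Boolₚ.not-¬ w~k (≁v w≢p))
      ... | no k≢p  | no k≢v   = ⊥-elim (Boolₚ.not-¬ w~k (none k (outsideN-leaf⁺ G v-leaf k≢v k≢p)))

  kind-mate : ∀ {w} → Kind w → Fin n
  kind-mate (matched j _ _ _) = j
  kind-mate {w} _             = w

  kind-role : ∀ {w} → Kind w → Role
  kind-role (hub _)               = centreᴿ
  kind-role (pendant _ _ _)       = leafᴿ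
  kind-role {w} (matched j _ _ _) = pairRole (adj G w p) (adj G j p) (toℕ w <ᵇ toℕ j)

  mate : Fin n → Fin n
  mate w = kind-mate (kind w)

  role : Fin n → Role
  role w = kind-role (kind w)

  record Matched (w : Fin n) : Set where
    constructor is-matched
    field
      w∈A      : w ∈ A
      mate∈A   : mate w ∈ A
      adjacent : adj G w (mate w) ≡ true

    neighbours : ∀ k → adj G w k ≡ true → k ≡ mate w ⊎ k ≡ p
    neighbours = matched-neighbours w∈A mate∈A adjacent

  data View (w : Fin n) : Set where
    centreᵛ    : role w ≡ centreᴿ → w ≡ p → mate w ≡ w → View w
    leafᵛ      : role w ≡ leafᴿ → ¬ w ≡ p → adj G w p ≡ true → (∀ k → adj G w k ≡ true → k ≡ p) →
                 mate w ≡ w → View w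
    triangle₁ᵛ : role w ≡ triangle₁ᴿ → Matched w → adj G w p ≡ true → adj G (mate w) p ≡ true →
                 toℕ w < toℕ (mate w) → View w
    triangle₂ᵛ : role w ≡ triangle₂ᴿ → Matched w → adj G w p ≡ true → adj G (mate w) p ≡ true →
                 toℕ (mate w) < toℕ w → View w
    innerᵛ     : role w ≡ innerᴿ → Matched w → adj G w p ≡ true → adj G (mate w) p ≡ false → View w
    outerᵛ     : role w ≡ outerᴿ → Matched w → adj G w p ≡ false → adj G (mate w) p ≡ true → View w

  view : ∀ w → View w
  view w with kind w in eq
  ... | hub w≡p               = centreᵛ (cong kind-role eq) w≡p (cong kind-mate eq)
  ... | pendant w≢p w~p only  = leafᵛ (cong kind-role eq) w≢p w~p only (cong kind-mate eq)
  ... | matched j w∈A j∈A w~j = matched-view (cong kind-role eq) (cong kind-mate eq) w∈A j∈A w~j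
    where
    matched-view : ∀ {j} → role w ≡ pairRole (adj G w p) (adj G j p) (toℕ w <ᵇ toℕ j) → mate w ≡ j →
                   w ∈ A → j ∈ A → adj G w j ≡ true → View w
    matched-view {j} r≡ refl w∈A j∈A w~j with adj G w p in w~p | adj G j p in j~p | toℕ w <ᵇ toℕ j in w<j
    ... | true  | true  | true  = triangle₁ᵛ r≡ (is-matched w∈A j∈A w~j) w~p j~p (<ᵇ⇒< w<j)
    ... | true  | true  | false = triangle₂ᵛ r≡ (is-matched w∈A j∈A w~j) w~p j~p
                                    (≤∧≢⇒< (≮⇒≥ (Boolₚ.not-¬ w<j ∘ <⇒<ᵇ)) (adj⇒≢ G w~j ∘ Finₚ.toℕ-injective ∘ sym))
    ... | true  | false | _     = innerᵛ r≡ (is-matched w∈A j∈A w~j) w~p j~p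
    ... | false | true  | _     = outerᵛ r≡ (is-matched w∈A j∈A w~j) w~p j~p
    ... | false | false | _ with () ← trans (sym (matched-spoke w∈A j∈A w~j)) (cong₂ _∨_ w~p j~p)

  open Matched

  mate-involutive-matched : ∀ {w} → Matched w → mate (mate w) ≡ w
  mate-involutive-matched {w} m with kind (mate w)
  ... | hub j≡p              = ⊥-elim (∈A⇒≢p (mate∈A m) j≡p)
  ... | pendant _ _ only     = ⊥-elim (∈A⇒≢p (w∈A m) (only w (adj-sym G (adjacent m))))
  ... | matched _ _ k∈A j~k = sym (max≤1 (w∈A m) (mate∈A m) k∈A (adj-sym G (adjacent m)) j~k)

  mate-involutive : ∀ w → mate (mate w) ≡ w
  mate-involutive w with view w
  ... | centreᵛ _ _ m≡w       = trans (cong mate m≡w) m≡w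
  ... | leafᵛ _ _ _ _ m≡w     = trans (cong mate m≡w) m≡w
  ... | triangle₁ᵛ _ m _ _ _  = mate-involutive-matched m
  ... | triangle₂ᵛ _ m _ _ _  = mate-involutive-matched m
  ... | innerᵛ _ m _ _        = mate-involutive-matched m
  ... | outerᵛ _ m _ _        = mate-involutive-matched m

  mate-injective : ∀ {a b} → mate a ≡ mate b → a ≡ b
  mate-injective {a} {b} eq = trans (sym (mate-involutive a)) (trans (cong mate eq) (mate-involutive b))

  Matched-mate : ∀ {w} → Matched w → Matched (mate w)
  Matched-mate {w} m = is-matched (mate∈A m) (subst (_∈ A) (sym (mate-involutive w)) (w∈A m))
    (subst (λ k → adj G (mate w) k ≡ true) (sym (mate-involutive w)) (adj-sym G (adjacent m)))

  role-matched : ∀ {w} → Matched w → role w ≡ pairRole (adj G w p) (adj G (mate w) p) (toℕ w <ᵇ toℕ (mate w))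
  role-matched {w} m with kind w
  ... | hub w≡p           = ⊥-elim (∈A⇒≢p (w∈A m) w≡p)
  ... | pendant _ _ only  = ⊥-elim (∈A⇒≢p (mate∈A m) (only _ (adjacent m)))
  ... | matched _ _ _ _   = refl

  role-of-mate : ∀ {w} → Matched w → role (mate w) ≡ pairRole (adj G (mate w) p) (adj G w p) (toℕ (mate w) <ᵇ toℕ w)
  role-of-mate m rewrite role-matched (Matched-mate m) | mate-involutive-matched m = refl

  role-mate : ∀ w → role (mate w) ≡ swapRole (role w)
  role-mate w with view w
  ... | centreᵛ r≡ _ m≡w              rewrite m≡w | r≡ = refl
  ... | leafᵛ r≡ _ _ _ m≡w            rewrite m≡w | r≡ = refl
  ... | triangle₁ᵛ r≡ m w~p m~p w<m
    rewrite role-of-mate m | m~p | w~p | ≤⇒<ᵇ-false (<⇒≤ w<m) | r≡ = refl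
  ... | triangle₂ᵛ r≡ m w~p m~p m<w   rewrite role-of-mate m | m~p | w~p | <⇒<ᵇ m<w | r≡ = refl
  ... | innerᵛ r≡ m w~p m≁p           rewrite role-of-mate m | m≁p | w~p | r≡ = refl
  ... | outerᵛ r≡ m w≁p m~p           rewrite role-of-mate m | m~p | w≁p | r≡ = refl

  isRole : Role → Fin n → Bool
  isRole r w = point r (role w)

  N : Role → ℕ
  N r = count (isRole r)

  role≡centreᴿ⇒≡p : ∀ {w} → role w ≡ centreᴿ → w ≡ p
  role≡centreᴿ⇒≡p {w} eq with view w
  ... | centreᵛ _ w≡p _        = w≡p
  ... | leafᵛ r≡ _ _ _ _       with () ← trans (sym r≡) eq
  ... | triangle₁ᵛ r≡ _ _ _ _  with () ← trans (sym r≡) eq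
  ... | triangle₂ᵛ r≡ _ _ _ _  with () ← trans (sym r≡) eq
  ... | innerᵛ r≡ _ _ _        with () ← trans (sym r≡) eq
  ... | outerᵛ r≡ _ _ _        with () ← trans (sym r≡) eq

  role-p : role p ≡ centreᴿ
  role-p with view p
  ... | centreᵛ r≡ _ _         = r≡
  ... | leafᵛ _ p≢p _ _ _      = ⊥-elim (p≢p refl)
  ... | triangle₁ᵛ _ m _ _ _   = ⊥-elim (∈A⇒≢p (w∈A m) refl)
  ... | triangle₂ᵛ _ m _ _ _   = ⊥-elim (∈A⇒≢p (w∈A m) refl)
  ... | innerᵛ _ m _ _         = ⊥-elim (∈A⇒≢p (w∈A m) refl)
  ... | outerᵛ _ m _ _         = ⊥-elim (∈A⇒≢p (w∈A m) refl)

  N-centre : N centreᴿ ≡ 1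
  N-centre = count-≡1 {f = isRole centreᴿ} (trans (cong (point centreᴿ) role-p) (point-self {6} centreᴿ))
                      (λ w → role≡centreᴿ⇒≡p ∘ point-true)

  N-swap : ∀ r → N (swapRole r) ≡ N r
  N-swap r = count-involution {f = isRole (swapRole r)} {isRole r} mate mate-involutive λ w → begin
    point (swapRole r) (role (mate w))            ≡⟨ cong (point (swapRole r)) (role-mate w) ⟩
    point (swapRole r) (swapRole (role w))
      ≡⟨ point-involution {σ = swapRole} swapRole-involutive (swapRole r) (role w) ⟩
    point (swapRole (swapRole r)) (role w)        ≡⟨ cong (λ a → point a (role w)) (swapRole-involutive r) ⟩
    point r (role w)                              ∎
    where open ≡-Reasoning

  spoke : Role → Bool
  spoke centreᴿ    = false
  spoke leafᴿ      = true
  spoke triangle₁ᴿ = true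
  spoke triangle₂ᴿ = true
  spoke innerᴿ     = true
  spoke outerᴿ     = false

  adj-centre : ∀ w → adj G p w ≡ spoke (role w)
  adj-centre w with view w
  ... | centreᵛ r≡ refl _          rewrite r≡ = irrefl G p
  ... | leafᵛ r≡ _ w~p _ _         rewrite r≡ = adj-sym G w~p
  ... | triangle₁ᵛ r≡ _ w~p _ _    rewrite r≡ = adj-sym G w~p
  ... | triangle₂ᵛ r≡ _ w~p _ _    rewrite r≡ = adj-sym G w~p
  ... | innerᵛ r≡ _ w~p _          rewrite r≡ = adj-sym G w~p
  ... | outerᵛ r≡ _ w≁p _          rewrite r≡ = trans (Graph.sym G p w) w≁p

  degreeOf : Role → ℕ
  degreeOf centreᴿ    = count (adj G p)
  degreeOf leafᴿ      = 1
  degreeOf triangle₁ᴿ = 2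
  degreeOf triangle₂ᴿ = 2
  degreeOf innerᴿ     = 2
  degreeOf outerᴿ     = 1

  private
    count-matched : ∀ {w} → Matched w → adj G w p ≡ true → count (adj G w) ≡ 2
    count-matched m w~p = count-≡2 w~p (adjacent m) (∈A⇒≢p (mate∈A m) ∘ sym) (Sum.swap ∘₂ neighbours m)

  degree-by-role : ∀ w → count (adj G w) ≡ degreeOf (role w)
  degree-by-role w with view w
  ... | centreᵛ r≡ refl _          rewrite r≡ = refl
  ... | leafᵛ r≡ _ w~p only _      rewrite r≡ = count-≡1 w~p only
  ... | triangle₁ᵛ r≡ m w~p _ _    rewrite r≡ = count-matched m w~p
  ... | triangle₂ᵛ r≡ m w~p _ _    rewrite r≡ = count-matched m w~p
  ... | innerᵛ r≡ m w~p _          rewrite r≡ = count-matched m w~p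
  ... | outerᵛ r≡ m w≁p _          rewrite r≡ = count-≡1 (adjacent m) only-mate
    where
    only-mate : ∀ k → adj G w k ≡ true → k ≡ mate w
    only-mate k w~k with neighbours m k w~k
    ... | inj₁ k≡mate = k≡mate
    ... | inj₂ refl   = ⊥-elim (Boolₚ.not-¬ w~k w≁p)

  counts : N triangle₁ᴿ ≡ 2 × N leafᴿ + 2 * N innerᴿ + 5 ≡ n
  counts = two-triangles {n} {N centreᴿ} {N leafᴿ} {N triangle₁ᴿ} {N triangle₂ᴿ} {N innerᴿ} {N outerᴿ}
                         N-centre (N-swap triangle₁ᴿ) (N-swap innerᴿ) vertex-count centre-degree degree-sum
    where
    vertex-count : n ≡ sum (λ r → 1 * N r)
    vertex-count = trans (sym (trans (sum-const n 1) (*-identityʳ n))) (sum-by-fibres role (λ _ → 1))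
    centre-degree : count (adj G p) ≡ sum (λ r → indicator (spoke r) * N r)
    centre-degree = trans (count-cong adj-centre) (sum-by-fibres role (indicator ∘ spoke))
    degree-sum : sum (λ r → degreeOf r * N r) ≡ 2 * (n + 1)
    degree-sum = begin
      sum (λ r → degreeOf r * N r)       ≡⟨ sum-by-fibres role degreeOf ⟨
      sum (λ w → degreeOf (role w))      ≡⟨ sum-cong-≗ degree-by-role ⟨
      sum (λ w → count (adj G w))        ≡⟨ handshake G ⟩
      2 * edgeCount G                    ≡⟨ cong (2 *_) (proj₂ bicyclic) ⟩
      2 * (n + 1)                        ∎
      where open ≡-Reasoning

  isRole-of : ∀ {w r} → role w ≡ r → isRole r w ≡ true
  isRole-of {r = r} eq = trans (cong (point r) eq) (point-self r)

  role-mate-of : ∀ {w r} → role w ≡ r → role (mate w) ≡ swapRole r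
  role-mate-of {w} eq = trans (role-mate w) (cong swapRole eq)

  off-centre : ∀ {w r} → role w ≡ r → ¬ r ≡ centreᴿ → ¬ w ≡ p
  off-centre eq r≢centre refl = r≢centre (trans (sym eq) role-p)

  neighbours-off-centre : ∀ {i} → ¬ i ≡ p → ∀ k → adj G i k ≡ true → k ≡ mate i ⊎ k ≡ p
  neighbours-off-centre {i} i≢p k i~k with view i
  ... | centreᵛ _ i≡p _        = ⊥-elim (i≢p i≡p)
  ... | leafᵛ _ _ _ only _     = inj₂ (only k i~k)
  ... | triangle₁ᵛ _ m _ _ _   = neighbours m k i~k
  ... | triangle₂ᵛ _ m _ _ _   = neighbours m k i~k
  ... | innerᵛ _ m _ _         = neighbours m k i~k
  ... | outerᵛ _ m _ _         = neighbours m k i~k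

  Matched-of-role : ∀ {w r} → role w ≡ r → ¬ r ≡ centreᴿ → ¬ r ≡ leafᴿ → Matched w
  Matched-of-role {w} eq r≢centre r≢leaf with view w
  ... | centreᵛ r≡ _ _         = ⊥-elim (r≢centre (trans (sym eq) r≡))
  ... | leafᵛ r≡ _ _ _ _       = ⊥-elim (r≢leaf (trans (sym eq) r≡))
  ... | triangle₁ᵛ _ m _ _ _   = m
  ... | triangle₂ᵛ _ m _ _ _   = m
  ... | innerᵛ _ m _ _         = m
  ... | outerᵛ _ m _ _         = m

  n₁ n₂ : ℕ
  n₁ = N leafᴿ
  n₂ = N innerᴿ

  open FLabels n₁ n₂

  label : Role → Fin n → FVertex
  label centreᴿ    _ = centre
  label leafᴿ      w = leaf (rank (isRole leafᴿ) w)
  label triangle₁ᴿ w = triangle (rank (isRole triangle₁ᴿ) w) false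
  label triangle₂ᴿ w = triangle (rank (isRole triangle₁ᴿ) (mate w)) true
  label innerᴿ     w = inner (rank (isRole innerᴿ) w)
  label outerᴿ     w = outer (rank (isRole innerᴿ) (mate w))

  form : Fin n → FVertex
  form w = label (role w) w

  private
    rank<N : ∀ {w r} → role w ≡ r → rank (isRole r) w < N r
    rank<N {r = r} eq = rank<count {f = isRole r} (isRole-of eq)

  form-in-range : ∀ w → InRange (form w)
  form-in-range w with role w in r≡
  ... | centreᴿ    = tt
  ... | leafᴿ      = rank<N r≡
  ... | triangle₁ᴿ = <-≤-trans (rank<N r≡) (≤-reflexive (proj₁ counts))
  ... | triangle₂ᴿ = <-≤-trans (rank<N (role-mate-of r≡)) (≤-reflexive (proj₁ counts))
  ... | innerᴿ     = rank<N r≡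
  ... | outerᴿ     = rank<N (role-mate-of r≡)

  private
    roleOf : FVertex → Role
    roleOf centre             = centreᴿ
    roleOf (triangle _ false) = triangle₁ᴿ
    roleOf (triangle _ true)  = triangle₂ᴿ
    roleOf (leaf _)           = leafᴿ
    roleOf (inner _)          = innerᴿ
    roleOf (outer _)          = outerᴿ

    index : FVertex → ℕ
    index centre         = 0
    index (triangle r _) = r
    index (leaf r)       = r
    index (inner r)      = r
    index (outer r)      = r

    roleOf-label : ∀ r w → roleOf (label r w) ≡ r
    roleOf-label centreᴿ    _ = refl
    roleOf-label leafᴿ      _ = refl
    roleOf-label triangle₁ᴿ _ = refl
    roleOf-label triangle₂ᴿ _ = refl
    roleOf-label innerᴿ     _ = refl
    roleOf-label outerᴿ     _ = refl

    rank-injective-on : ∀ {r a b} → role a ≡ r → role b ≡ r → rank (isRole r) a ≡ rank (isRole r) b → a ≡ b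
    rank-injective-on ra rb = rank-injective (isRole-of ra) (isRole-of rb)

    label-injective : ∀ r {a b} → role a ≡ r → role b ≡ r → label r a ≡ label r b → a ≡ b
    label-injective centreᴿ    ra rb _  = trans (role≡centreᴿ⇒≡p ra) (sym (role≡centreᴿ⇒≡p rb))
    label-injective leafᴿ      ra rb eq = rank-injective-on ra rb (cong index eq)
    label-injective triangle₁ᴿ ra rb eq = rank-injective-on ra rb (cong index eq)
    label-injective triangle₂ᴿ ra rb eq =
      mate-injective (rank-injective-on (role-mate-of ra) (role-mate-of rb) (cong index eq))
    label-injective innerᴿ     ra rb eq = rank-injective-on ra rb (cong index eq)
    label-injective outerᴿ     ra rb eq =
      mate-injective (rank-injective-on (role-mate-of ra) (role-mate-of rb) (cong index eq))

  form-injective : ∀ {a b} → form a ≡ form b → a ≡ b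
  form-injective {a} {b} eq =
    label-injective (role a) refl (sym same-role) (trans eq (cong (λ r → label r b) (sym same-role)))
    where
    same-role : role a ≡ role b
    same-role = trans (sym (roleOf-label (role a) a)) (trans (cong roleOf eq) (roleOf-label (role b) b))

  private
    F-adj-centre : ∀ r w → F-adj centre (label r w) ≡ spoke r
    F-adj-centre centreᴿ    _ = refl
    F-adj-centre leafᴿ      _ = refl
    F-adj-centre triangle₁ᴿ _ = refl
    F-adj-centre triangle₂ᴿ _ = refl
    F-adj-centre innerᴿ     _ = refl
    F-adj-centre outerᴿ     _ = refl

    hub-row : ∀ {i j b} → role i ≡ centreᴿ → role j ≡ b → adj G i j ≡ F-adj centre (label b j)
    hub-row {j = j} {b} rᵢ rⱼ with refl ← role≡centreᴿ⇒≡p rᵢ =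
      trans (adj-centre j) (trans (cong spoke rⱼ) (sym (F-adj-centre b j)))

    hub-column : ∀ {i j a} → role i ≡ a → role j ≡ centreᴿ → adj G i j ≡ F-adj (label a i) centre
    hub-column {i} {j} {a} rᵢ rⱼ =
      trans (Graph.sym G i j)
            (trans (hub-row rⱼ rᵢ) (Boolₚ.∨-comm (arc centre (label a i)) (arc (label a i) centre)))

    leaf-only-p : ∀ {i} → role i ≡ leafᴿ → ∀ k → adj G i k ≡ true → k ≡ p
    leaf-only-p {i} eq with view i
    ... | centreᵛ r≡ _ _         with () ← trans (sym eq) r≡
    ... | leafᵛ _ _ _ only _     = only
    ... | triangle₁ᵛ r≡ _ _ _ _  with () ← trans (sym eq) r≡
    ... | triangle₂ᵛ r≡ _ _ _ _  with () ← trans (sym eq) r≡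
    ... | innerᵛ r≡ _ _ _        with () ← trans (sym eq) r≡
    ... | outerᵛ r≡ _ _ _        with () ← trans (sym eq) r≡

    leaf-apart : ∀ {i j b} → role i ≡ leafᴿ → role j ≡ b → ¬ b ≡ centreᴿ → adj G i j ≡ false
    leaf-apart {j = j} rᵢ rⱼ b≢centre = Boolₚ.¬-not (off-centre rⱼ b≢centre ∘ leaf-only-p rᵢ j)

    apart : ∀ {i j a b} → role i ≡ a → role j ≡ b → ¬ a ≡ centreᴿ → ¬ b ≡ centreᴿ → ¬ b ≡ swapRole a →
            adj G i j ≡ false
    apart {j = j} rᵢ rⱼ a≢centre b≢centre b≢swap-a = Boolₚ.¬-not λ i~j →
      Sum.[ (λ j≡mate → b≢swap-a (trans (sym rⱼ) (trans (cong role j≡mate) (role-mate-of rᵢ))))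
          , off-centre rⱼ b≢centre ]
          (neighbours-off-centre (off-centre rᵢ a≢centre) j i~j)

    partners : ∀ {i j r} → role i ≡ r → role (mate j) ≡ r → ¬ r ≡ centreᴿ → ¬ r ≡ leafᴿ → ¬ j ≡ p →
               adj G i j ≡ (rank (isRole r) i ≡ᵇ rank (isRole r) (mate j))
    partners {i} {j} {r} rᵢ rⱼ r≢centre r≢leaf j≢p with j ≟ mate i
    ... | yes refl rewrite mate-involutive i =
      trans (adjacent (Matched-of-role rᵢ r≢centre r≢leaf)) (sym (≡ᵇ-refl (rank (isRole r) i)))
    ... | no j≢mate = trans (Boolₚ.¬-not (Sum.[ j≢mate , j≢p ] ∘ neighbours-off-centre (off-centre rᵢ r≢centre) j))
                            (sym (≢⇒≡ᵇ-false (j≢mate ∘ mate-rank)))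
      where
      mate-rank : rank (isRole r) i ≡ rank (isRole r) (mate j) → j ≡ mate i
      mate-rank eq = trans (sym (mate-involutive j)) (cong mate (sym (rank-injective-on rᵢ rⱼ eq)))

  adj-form : ∀ i j → adj G i j ≡ F-adj (form i) (form j)
  adj-form i j with role i in rᵢ | role j in rⱼ
  ... | centreᴿ    | _          = hub-row rᵢ rⱼ
  ... | _          | centreᴿ    = hub-column rᵢ rⱼ
  ... | leafᴿ      | leafᴿ      = leaf-apart rᵢ rⱼ (λ ())
  ... | leafᴿ      | triangle₁ᴿ = leaf-apart rᵢ rⱼ (λ ())
  ... | leafᴿ      | triangle₂ᴿ = leaf-apart rᵢ rⱼ (λ ())
  ... | leafᴿ      | innerᴿ     = leaf-apart rᵢ rⱼ (λ ())
  ... | leafᴿ      | outerᴿ     = leaf-apart rᵢ rⱼ (λ ())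
  ... | triangle₁ᴿ | leafᴿ      = apart rᵢ rⱼ (λ ()) (λ ()) (λ ())
  ... | triangle₁ᴿ | triangle₁ᴿ = apart rᵢ rⱼ (λ ()) (λ ()) (λ ())
  ... | triangle₁ᴿ | triangle₂ᴿ =
    trans (partners rᵢ (role-mate-of rⱼ) (λ ()) (λ ()) (off-centre rⱼ (λ ()))) (sym (∨-identityʳ _))
  ... | triangle₁ᴿ | innerᴿ     = apart rᵢ rⱼ (λ ()) (λ ()) (λ ())
  ... | triangle₁ᴿ | outerᴿ     = apart rᵢ rⱼ (λ ()) (λ ()) (λ ())
  ... | triangle₂ᴿ | leafᴿ      = apart rᵢ rⱼ (λ ()) (λ ()) (λ ())
  ... | triangle₂ᴿ | triangle₁ᴿ =
    trans (Graph.sym G i j) (partners rⱼ (role-mate-of rᵢ) (λ ()) (λ ()) (off-centre rᵢ (λ ())))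
  ... | triangle₂ᴿ | triangle₂ᴿ = apart rᵢ rⱼ (λ ()) (λ ()) (λ ())
  ... | triangle₂ᴿ | innerᴿ     = apart rᵢ rⱼ (λ ()) (λ ()) (λ ())
  ... | triangle₂ᴿ | outerᴿ     = apart rᵢ rⱼ (λ ()) (λ ()) (λ ())
  ... | innerᴿ     | leafᴿ      = apart rᵢ rⱼ (λ ()) (λ ()) (λ ())
  ... | innerᴿ     | triangle₁ᴿ = apart rᵢ rⱼ (λ ()) (λ ()) (λ ())
  ... | innerᴿ     | triangle₂ᴿ = apart rᵢ rⱼ (λ ()) (λ ()) (λ ())
  ... | innerᴿ     | innerᴿ     = apart rᵢ rⱼ (λ ()) (λ ()) (λ ())
  ... | innerᴿ     | outerᴿ     =
    trans (partners rᵢ (role-mate-of rⱼ) (λ ()) (λ ()) (off-centre rⱼ (λ ()))) (sym (∨-identityʳ _))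
  ... | outerᴿ     | leafᴿ      = apart rᵢ rⱼ (λ ()) (λ ()) (λ ())
  ... | outerᴿ     | triangle₁ᴿ = apart rᵢ rⱼ (λ ()) (λ ()) (λ ())
  ... | outerᴿ     | triangle₂ᴿ = apart rᵢ rⱼ (λ ()) (λ ()) (λ ())
  ... | outerᴿ     | innerᴿ     =
    trans (Graph.sym G i j) (partners rⱼ (role-mate-of rᵢ) (λ ()) (λ ()) (off-centre rᵢ (λ ())))
  ... | outerᴿ     | outerᴿ     = apart rᵢ rⱼ (λ ()) (λ ()) (λ ())

  private
    embed : Fin n → Fin order
    embed w = fromℕ< (encode<order (form w) (form-in-range w))

    toℕ-embed : ∀ w → toℕ (embed w) ≡ encode (form w)
    toℕ-embed w = Finₚ.toℕ-fromℕ< (encode<order (form w) (form-in-range w))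

    embed-injective : ∀ {a b} → embed a ≡ embed b → a ≡ b
    embed-injective {a} {b} eq = form-injective (encode-injective (form-in-range a) (form-in-range b)
      (trans (sym (toℕ-embed a)) (trans (cong toℕ eq) (toℕ-embed b))))

    n≡order : n ≡ order
    n≡order = trans (sym (proj₂ counts)) (+-comm (n₁ + 2 * n₂) 5)

  isomorphic : Iso G (F n₁ n₂)
  isomorphic with bijection , to≗embed ← injective⇒↔ embed embed-injective n≡order =
    bijection , λ i j → begin
      adj (F n₁ n₂) (Inverse.to bijection i) (Inverse.to bijection j)
        ≡⟨ cong₂ (adj (F n₁ n₂)) (to≗embed i) (to≗embed j) ⟩
      adj-code (toℕ (embed i)) (toℕ (embed j))
        ≡⟨ cong₂ adj-code (toℕ-embed i) (toℕ-embed j) ⟩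
      adj-code (encode (form i)) (encode (form j))
        ≡⟨ adj-code-encode (form-in-range i) (form-in-range j) ⟩
      F-adj (form i) (form j)
        ≡⟨ adj-form i j ⟨
      adj G i j
        ∎
    where open ≡-Reasoning

lemma4p2 : ∀ (n : ℕ) (G : Graph n) → Bicyclic G → Σ (Fin n) (IsLeaf G)
         → (∀ (n₁ n₂ : ℕ) → n₁ + 2 * n₂ + 5 ≡ n → ¬ Iso G (F n₁ n₂))
         → ∀ (v : Fin n) → IsLeaf G v → ∀ (u : Fin n) → IsLeaf (B n) u
         → CSLe (B n) (outsideN (B n) u) G (outsideN G v)
lemma4p2 n G bicyclic _ not-F v v-leaf u u-leaf with B-leaf {n} {u} u-leaf | leaf-neighbour G v-leaf
... | order-two   | _ = CSLe-from-empty (B 2) G (outsideN-B₂-empty u)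
... | further 4≤u | p , v-only-p with path₃-or-maxDegree≤1 G (outsideN G v)
...   | inj₁ path = CSLe-from-path₃ G v-only-p 4≤u path
...   | inj₂ max≤1 = ⊥-elim (not-F n₁ n₂ (proj₂ counts) isomorphic)
  where open Recognition G bicyclic v-only-p max≤1
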